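{- The triangle complexes $\Delta(\mathrm{AG}(2,q))$, for $q>3$ a prime power, form an infinite family of thick, residually connected and flag-transitive geometries that admit trialities but no dualities.
   Context: $\mathrm{AG}(2,q)$ is the affine plane over $\mathrm{GF}(q)$ as a rank two geometry of points and lines. Triangle complex: $\Delta(\Gamma)$ is the rank three incidence system over $\{1,2,3\}$ whose elements are the triples $(p,L,i)$ with $p$ incident with $L$ and $i\in\{1,2,3\}$; the type of $(p,L,i)$ is $i$; and $(p,L,i)$ is incident with $(p',L',i \bmod 3+1)$ if and only if the set of points incident with both $L$ and $L'$ is exactly $\{p\}$ and $p\neq p'$ (incidence symmetric and reflexive, no other incidences). A geometry is thick if every flag not containing elements of all types lies in at least three chambers; residually connected if the incidence graph of every residue of rank at least $2$ (including the whole geometry) is connected; flag-transitive if its type-preserving automorphism group is transitive on chambers. A correlation is a bijection preserving incidence and sending elements of equal type to elements of equal type; a duality is a correlation of order $2$ inducing a transposition on the types; a triality is a correlation of order $3$ inducing a $3$-cycle on the types. -}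

module Defs where

open import Level using (0ℓ)
open import Data.Nat using (ℕ)
open import Data.Fin using (Fin; zero; suc)
open import Data.Maybe using (Maybe; just; nothing)
open import Data.Product using (Σ; ∃; ∃-syntax; _×_; _,_)
open import Data.Sum using (_⊎_)
open import Relation.Nullary using (¬_)
open import Relation.Binary.PropositionalEquality using (_≡_)
open import Relation.Binary.Construct.Closure.ReflexiveTransitive using (Star)
open import Algebra.Structures using (IsCommutativeRing)
open import Function using (_∘_)
open import Function.Bundles using (_↔_; Inverse)

-- Finite fields of order q, with carrier Fin q (every finite field of
-- order q is isomorphic to one of these; GF(q)).

record FiniteField (q : ℕ) : Set where
  field
    _+_ _*_ : Fin q → Fin q → Fin q
    -_      : Fin q → Fin q
    0# 1#   : Fin q
    isCommutativeRing : IsCommutativeRing _≡_ _+_ _*_ -_ 0# 1#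
    0≢1     : ¬ (0# ≡ 1#)
    inverse : ∀ x → ¬ (x ≡ 0#) → ∃[ y ] (x * y ≡ 1#)

module AffinePlane {q : ℕ} (F : FiniteField q) where
  open FiniteField F

  Point : Set
  Point = Fin q × Fin q

  data Line : Set where
    slope : (m b : Fin q) → Line
    vert  : (c : Fin q) → Line

  _I_ : Point → Line → Set
  (x , y) I slope m b = y ≡ (m * x) + b
  (x , y) I vert c    = x ≡ c

record IncSys (n : ℕ) : Set₁ where
  field
    X   : Set
    typ : X → Fin n
    _∗_ : X → X → Set

module IncSysNotions {n : ℕ} (Γ : IncSys n) where
  open IncSys Γ

  record Flag : Set where
    field
      el       : Fin n → Maybe X
      typed    : ∀ i x → el i ≡ just x → typ x ≡ i
      pairwise : ∀ i j x y → el i ≡ just x → el j ≡ just y → x ∗ y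
  open Flag public

  record Chamber : Set where
    field
      ch     : Fin n → X
      ctyped : ∀ i → typ (ch i) ≡ i
      cinc   : ∀ i j → ch i ∗ ch j
  open Chamber public

  _⊆C_ : Flag → Chamber → Set
  F ⊆C C = ∀ i x → el F i ≡ just x → ch C i ≡ x

  _≢C_ : Chamber → Chamber → Set
  C ≢C D = ¬ (∀ i → ch C i ≡ ch D i)

  IsGeometry : Set
  IsGeometry = ∀ (F : Flag) → ∃[ C ] (F ⊆C C)

  Thick : Set
  Thick = ∀ (F : Flag) → (∃[ i ] (el F i ≡ nothing)) →
    ∃[ C₁ ] ∃[ C₂ ] ∃[ C₃ ]
      (F ⊆C C₁ × F ⊆C C₂ × F ⊆C C₃ ×
       C₁ ≢C C₂ × C₁ ≢C C₃ × C₂ ≢C C₃)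

  InRes : Flag → X → Set
  InRes F x = (el F (typ x) ≡ nothing) × (∀ i y → el F i ≡ just y → x ∗ y)

  RankAtLeast2 : Flag → Set
  RankAtLeast2 F = ∃[ i ] ∃[ j ] (¬ (i ≡ j) × el F i ≡ nothing × el F j ≡ nothing)

  ResEdge : Flag → X → X → Set
  ResEdge F x y = InRes F x × InRes F y × x ∗ y

  ResiduallyConnected : Set
  ResiduallyConnected = ∀ (F : Flag) → RankAtLeast2 F →
    ∀ x y → InRes F x → InRes F y → Star (ResEdge F) x y

  PreservesInc : (X ↔ X) → Set
  PreservesInc φ = ∀ x y → (x ∗ y → Inverse.to φ x ∗ Inverse.to φ y)
                         × (Inverse.to φ x ∗ Inverse.to φ y → x ∗ y)

  record Automorphism : Set where
    field
      φ        : X ↔ X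
      inc      : PreservesInc φ
      typePres : ∀ x → typ (Inverse.to φ x) ≡ typ x

  FlagTransitive : Set
  FlagTransitive = ∀ (C D : Chamber) →
    ∃[ α ] (∀ i → Inverse.to (Automorphism.φ α) (ch C i) ≡ ch D i)

  record Correlation : Set where
    field
      φ       : X ↔ X
      inc     : PreservesInc φ
      typeRes : ∀ x y → typ x ≡ typ y →
                typ (Inverse.to φ x) ≡ typ (Inverse.to φ y)

  Induces : Correlation → (Fin n → Fin n) → Set
  Induces c σ = ∀ x → typ (Inverse.to (Correlation.φ c) x) ≡ σ (typ x)

  HasOrder2 : (X → X) → Set
  HasOrder2 f = (∀ x → f (f x) ≡ x) × ¬ (∀ x → f x ≡ x)

  HasOrder3 : (X → X) → Set
  HasOrder3 f = (∀ x → f (f (f x)) ≡ x) × ¬ (∀ x → f x ≡ x)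

  IsTransposition : (Fin n → Fin n) → Set
  IsTransposition σ = ∃[ i ] ∃[ j ] (¬ (i ≡ j) × σ i ≡ j × σ j ≡ i ×
    (∀ k → ¬ (k ≡ i) → ¬ (k ≡ j) → σ k ≡ k))

  Is3Cycle : (Fin n → Fin n) → Set
  Is3Cycle σ = ∃[ i ] ∃[ j ] ∃[ k ] (¬ (i ≡ j) × ¬ (j ≡ k) × ¬ (i ≡ k) ×
    σ i ≡ j × σ j ≡ k × σ k ≡ i ×
    (∀ l → ¬ (l ≡ i) → ¬ (l ≡ j) → ¬ (l ≡ k) → σ l ≡ l))

  IsDuality : Correlation → Set
  IsDuality c = HasOrder2 (Inverse.to (Correlation.φ c)) ×
                ∃[ σ ] (Induces c σ × IsTransposition σ)

  IsTriality : Correlation → Set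
  IsTriality c = HasOrder3 (Inverse.to (Correlation.φ c)) ×
                 ∃[ σ ] (Induces c σ × Is3Cycle σ)

  AdmitsDuality : Set
  AdmitsDuality = ∃[ c ] IsDuality c

  AdmitsTriality : Set
  AdmitsTriality = ∃[ c ] IsTriality c

-- Triangle complex Δ(Γ) of a rank two geometry of points and lines.
-- Types {1,2,3} are encoded as Fin 3 = {0,1,2}; i mod 3 + 1 becomes next.

next : Fin 3 → Fin 3
next zero = suc zero
next (suc zero) = suc (suc zero)
next (suc (suc zero)) = zero

module TriangleComplex {P L : Set} (_I_ : P → L → Set) where

  record Elem : Set where
    constructor elem
    field
      pt  : P
      ln  : L
      inc : pt I ln
      ty  : Fin 3

  open Elem public

  MeetExactly : L → L → P → Set
  MeetExactly ℓ ℓ' p = ∀ x → ((x I ℓ × x I ℓ') → x ≡ p) × (x ≡ p → (x I ℓ × x I ℓ'))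

  Adj : Elem → Elem → Set
  Adj a b = (ty b ≡ next (ty a)) × MeetExactly (ln a) (ln b) (pt a) × ¬ (pt a ≡ pt b)

  _∗_ : Elem → Elem → Set
  a ∗ b = (a ≡ b) ⊎ Adj a b ⊎ Adj b a

  Δ : IncSys 3
  Δ = record { X = Elem ; typ = ty ; _∗_ = _∗_ }

ΔAG : ∀ {q} → FiniteField q → IncSys 3
ΔAG F = TriangleComplex.Δ (AffinePlane._I_ F)

-- The chambers of Δ(AG(2,q)) are exactly the non-collinear triangles a₀ a₁ a₂, the element of type i
-- being (aᵢ, aᵢa_{i-1}, i). Affine maps therefore act transitively on chambers, and shifting every type
-- by one is a triality. A chamber containing a flag that misses type t still contains it after the
-- vertex of type t moves along its side through the vertex of type t+1, which leaves q - 1 ≥ 3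
-- choices; the residue of a single element is connected through one fixed element of it.
-- A duality swaps two types s, s+1 and fixes s+2. For elements of type s+1, having a common neighbour
-- of type s but none of type s+2 just means being distinct elements on one line, a transitive
-- relation. For elements of type s, having a common neighbour of type s+1 but none of type s+2 is not
-- transitive: it fails for the elements of type s at (0,0), (0,0), (1,1) on the lines y = 0, x = 0, x = 1.

module Submission where

open import Level using (0ℓ)
open import Data.Nat as ℕ using (ℕ; zero; suc; _<_)
import Data.Nat.Properties as ℕ
open import Data.Integer as ℤ using (ℤ; +_; -[1+_]; _⊖_; _◃_)
import Data.Integer.Properties as ℤ
open import Data.Sign as Sign using ()
open import Data.Fin as Fin using (Fin; zero; suc)
import Data.Fin.Properties as Fin
open import Data.Maybe using (Maybe; just; nothing)
open import Data.Maybe.Properties using (just-injective)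
open import Data.Product using (_×_; _,_; proj₁; proj₂; ∃; ∃-syntax)
open import Data.Product.Properties using (≡-dec)
open import Data.Sum using (_⊎_; inj₁; inj₂)
open import Data.Empty using (⊥-elim)
open import Function using (_∘_; _$_; id)
open import Function.Definitions using (Injective)
open import Function.Bundles using (_↔_; Inverse; Injection; mk↔ₛ′)
open import Function.Construct.Symmetry using (↔-sym)
open import Function.Construct.Composition using (_↔-∘_)
open import Function.Properties.Inverse using (↔⇒↣)
open import Relation.Nullary using (¬_; yes; no; ¬?; contradiction)
open import Relation.Nullary.Decidable using (decidable-stable)
open import Relation.Binary.Definitions using (DecidableEquality)
open import Relation.Binary.PropositionalEquality as ≡ using (_≡_; _≢_)
open import Relation.Binary.Construct.Closure.ReflexiveTransitive using (Star; ε; _◅_; _◅◅_; reverse; gmap)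
import Axiom.UniquenessOfIdentityProofs as UIP
open import Algebra.Bundles using (CommutativeRing)
open import Algebra.Solver.Ring.AlmostCommutativeRing using (fromCommutativeRing; _-Raw-AlmostCommutative⟶_)
open import Defs

prev : Fin 3 → Fin 3
prev t = next (next t)

next³ : ∀ t → next (next (next t)) ≡ t
next³ zero             = ≡.refl
next³ (suc zero)       = ≡.refl
next³ (suc (suc zero)) = ≡.refl

next≢id : ∀ t → next t ≢ t
next≢id zero             ()
next≢id (suc zero)       ()
next≢id (suc (suc zero)) ()

prev≢id : ∀ t → prev t ≢ t
prev≢id zero             ()
prev≢id (suc zero)       ()
prev≢id (suc (suc zero)) ()

next-injective : ∀ {s t} → next s ≡ next t → s ≡ t
next-injective {s} {t} e = ≡.trans (≡.sym (next³ s)) (≡.trans (≡.cong prev e) (next³ t))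

next-cases : ∀ i t → i ≡ t ⊎ i ≡ next t ⊎ i ≡ prev t
next-cases zero             zero             = inj₁ ≡.refl
next-cases zero             (suc zero)       = inj₂ (inj₂ ≡.refl)
next-cases zero             (suc (suc zero)) = inj₂ (inj₁ ≡.refl)
next-cases (suc zero)       zero             = inj₂ (inj₁ ≡.refl)
next-cases (suc zero)       (suc zero)       = inj₁ ≡.refl
next-cases (suc zero)       (suc (suc zero)) = inj₂ (inj₂ ≡.refl)
next-cases (suc (suc zero)) zero             = inj₂ (inj₂ ≡.refl)
next-cases (suc (suc zero)) (suc zero)       = inj₂ (inj₁ ≡.refl)
next-cases (suc (suc zero)) (suc (suc zero)) = inj₁ ≡.refl

complement-next-prev : ∀ {i j} → i ≢ j → ∃[ t ] ((next t ≡ i × prev t ≡ j) ⊎ (next t ≡ j × prev t ≡ i))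
complement-next-prev {zero}             {zero}             i≢j = contradiction ≡.refl i≢j
complement-next-prev {zero}             {suc zero}         _   = suc (suc zero) , inj₁ (≡.refl , ≡.refl)
complement-next-prev {zero}             {suc (suc zero)}   _   = suc zero , inj₂ (≡.refl , ≡.refl)
complement-next-prev {suc zero}         {zero}             _   = suc (suc zero) , inj₂ (≡.refl , ≡.refl)
complement-next-prev {suc zero}         {suc zero}         i≢j = contradiction ≡.refl i≢j
complement-next-prev {suc zero}         {suc (suc zero)}   _   = zero , inj₁ (≡.refl , ≡.refl)
complement-next-prev {suc (suc zero)}   {zero}             _   = suc zero , inj₁ (≡.refl , ≡.refl)
complement-next-prev {suc (suc zero)}   {suc zero}         _   = zero , inj₂ (≡.refl , ≡.refl)
complement-next-prev {suc (suc zero)}   {suc (suc zero)}   i≢j = contradiction ≡.refl i≢j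

∃-∉-image : ∀ {k n} → k ℕ.< n → (f : Fin k → Fin n) → ∃[ x ] (∀ i → x ≢ f i)
∃-∉-image {k} k<n f with Fin.any? (λ x → Fin.all? (λ i → ¬? (x Fin.≟ f i)))
... | yes found = found
... | no none = contradiction (Fin.injective⇒≤ preimage-injective) (ℕ.<⇒≱ k<n)
  where
  preimage : ∀ x → ∃[ i ] (x ≡ f i)
  preimage x with Fin.¬∀⟶∃¬ k _ (λ i → ¬? (x Fin.≟ f i)) (λ all → none (x , all))
  ... | i , ¬x≢fi = i , decidable-stable (x Fin.≟ f i) ¬x≢fi
  preimage-injective : Injective _≡_ _≡_ (proj₁ ∘ preimage)
  preimage-injective {x} {y} e =
    ≡.trans (proj₂ (preimage x)) (≡.trans (≡.cong f e) (≡.sym (proj₂ (preimage y))))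

avoid₂ : ∀ {n} → 2 ℕ.< n → (a b : Fin n) → ∃[ x ] (x ≢ a × x ≢ b)
avoid₂ 2<n a b with ∃-∉-image 2<n (λ { zero → a ; (suc _) → b })
... | x , x∉ = x , x∉ zero , x∉ (suc zero)

avoid₃ : ∀ {n} → 3 ℕ.< n → (a b c : Fin n) → ∃[ x ] (x ≢ a × x ≢ b × x ≢ c)
avoid₃ 3<n a b c with ∃-∉-image 3<n (λ { zero → a ; (suc zero) → b ; (suc (suc _)) → c })
... | x , x∉ = x , x∉ zero , x∉ (suc zero) , x∉ (suc (suc zero))

module IntegerCoefficients {c ℓ} (R : CommutativeRing c ℓ) where
  open CommutativeRing R
  open import Algebra.Properties.Ring ring using (-0#≈0#; -‿involutive; -‿+-comm; -‿distribˡ-*; -‿distribʳ-*)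
  open import Algebra.Properties.Monoid.Mult.TCOptimised +-monoid using (×-homo-+; 1+×) renaming (_×_ to _×ℕ_)
  open import Algebra.Properties.Semiring.Mult.TCOptimised semiring using (×1-homo-*)
  open import Relation.Binary.Reasoning.Setoid setoid

  ⟦_⟧ : ℤ → Carrier
  ⟦ + n ⟧      = n ×ℕ 1#
  ⟦ -[1+ n ] ⟧ = - (suc n ×ℕ 1#)

  private
    cancel-1+ : ∀ a b → (1# + a) - (1# + b) ≈ a - b
    cancel-1+ a b = begin
      (1# + a) + - (1# + b)     ≈⟨ +-cong (+-comm a 1#) (-‿+-comm 1# b) ⟨
      (a + 1#) + (- 1# + - b)   ≈⟨ +-assoc a 1# _ ⟩
      a + (1# + (- 1# + - b))   ≈⟨ +-congˡ (+-assoc 1# _ _) ⟨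
      a + ((1# + - 1#) + - b)   ≈⟨ +-congˡ (+-congʳ (-‿inverseʳ 1#)) ⟩
      a + (0# + - b)            ≈⟨ +-congˡ (+-identityˡ _) ⟩
      a - b                     ∎

  ⊖-homo : ∀ m n → ⟦ m ⊖ n ⟧ ≈ m ×ℕ 1# - n ×ℕ 1#
  ⊖-homo m       zero    = sym (trans (+-congˡ -0#≈0#) (+-identityʳ _))
  ⊖-homo zero    (suc n) = sym (+-identityˡ _)
  ⊖-homo (suc m) (suc n) = begin
    ⟦ suc m ⊖ suc n ⟧                 ≡⟨ ≡.cong ⟦_⟧ (ℤ.[1+m]⊖[1+n]≡m⊖n m n) ⟩
    ⟦ m ⊖ n ⟧                         ≈⟨ ⊖-homo m n ⟩
    m ×ℕ 1# - n ×ℕ 1#                 ≈⟨ cancel-1+ _ _ ⟨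
    (1# + m ×ℕ 1#) - (1# + n ×ℕ 1#)   ≈⟨ +-cong (1+× m 1#) (-‿cong (1+× n 1#)) ⟨
    suc m ×ℕ 1# - suc n ×ℕ 1#         ∎

  +-homo : ∀ i j → ⟦ i ℤ.+ j ⟧ ≈ ⟦ i ⟧ + ⟦ j ⟧
  +-homo -[1+ m ] -[1+ n ] = begin
    - (suc (suc (m ℕ.+ n)) ×ℕ 1#)       ≡⟨ ≡.cong (λ k → - (suc k ×ℕ 1#)) (ℕ.+-suc m n) ⟨
    - ((suc m ℕ.+ suc n) ×ℕ 1#)         ≈⟨ -‿cong (×-homo-+ 1# (suc m) (suc n)) ⟩
    - (suc m ×ℕ 1# + suc n ×ℕ 1#)       ≈⟨ -‿+-comm _ _ ⟨
    - (suc m ×ℕ 1#) + - (suc n ×ℕ 1#)   ∎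
  +-homo -[1+ m ] (+ n)    = trans (⊖-homo n (suc m)) (+-comm _ _)
  +-homo (+ m)    -[1+ n ] = ⊖-homo m (suc n)
  +-homo (+ m)    (+ n)    = ×-homo-+ 1# m n

  +◃-homo : ∀ k → ⟦ Sign.+ ◃ k ⟧ ≈ k ×ℕ 1#
  +◃-homo zero    = refl
  +◃-homo (suc k) = refl

  -◃-homo : ∀ k → ⟦ Sign.- ◃ k ⟧ ≈ - (k ×ℕ 1#)
  -◃-homo zero    = sym -0#≈0#
  -◃-homo (suc k) = refl

  *-homo : ∀ i j → ⟦ i ℤ.* j ⟧ ≈ ⟦ i ⟧ * ⟦ j ⟧
  *-homo (+ m)    (+ n)    = trans (+◃-homo (m ℕ.* n)) (×1-homo-* m n)
  *-homo (+ m)    -[1+ n ] = begin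
    ⟦ Sign.- ◃ (m ℕ.* suc n) ⟧   ≈⟨ -◃-homo (m ℕ.* suc n) ⟩
    - ((m ℕ.* suc n) ×ℕ 1#)      ≈⟨ -‿cong (×1-homo-* m (suc n)) ⟩
    - (m ×ℕ 1# * suc n ×ℕ 1#)    ≈⟨ -‿distribʳ-* _ _ ⟩
    m ×ℕ 1# * - (suc n ×ℕ 1#)    ∎
  *-homo -[1+ m ] (+ n)    = begin
    ⟦ Sign.- ◃ (suc m ℕ.* n) ⟧   ≈⟨ -◃-homo (suc m ℕ.* n) ⟩
    - ((suc m ℕ.* n) ×ℕ 1#)      ≈⟨ -‿cong (×1-homo-* (suc m) n) ⟩
    - (suc m ×ℕ 1# * n ×ℕ 1#)    ≈⟨ -‿distribˡ-* _ _ ⟩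
    - (suc m ×ℕ 1#) * n ×ℕ 1#    ∎
  *-homo -[1+ m ] -[1+ n ] = begin
    (suc m ℕ.* suc n) ×ℕ 1#             ≈⟨ ×1-homo-* (suc m) (suc n) ⟩
    suc m ×ℕ 1# * suc n ×ℕ 1#           ≈⟨ -‿involutive _ ⟨
    - - (suc m ×ℕ 1# * suc n ×ℕ 1#)     ≈⟨ -‿cong (-‿distribˡ-* _ _) ⟩
    - (- (suc m ×ℕ 1#) * suc n ×ℕ 1#)   ≈⟨ -‿distribʳ-* _ _ ⟩
    - (suc m ×ℕ 1#) * - (suc n ×ℕ 1#)   ∎

  -‿homo : ∀ i → ⟦ ℤ.- i ⟧ ≈ - ⟦ i ⟧
  -‿homo (+ zero)  = sym -0#≈0#
  -‿homo (+ suc n) = refl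
  -‿homo -[1+ n ]  = sym (-‿involutive _)

  homomorphism : ℤ.+-*-rawRing -Raw-AlmostCommutative⟶ fromCommutativeRing R
  homomorphism = record
    { ⟦_⟧ = ⟦_⟧ ; +-homo = +-homo ; *-homo = *-homo ; -‿homo = -‿homo
    ; 0-homo = refl ; 1-homo = refl }

  coefficient-≟ : ∀ i j → Maybe (⟦ i ⟧ ≈ ⟦ j ⟧)
  coefficient-≟ i j with i ℤ.≟ j
  ... | yes ≡.refl = just refl
  ... | no _       = nothing

  open import Algebra.Solver.Ring ℤ.+-*-rawRing (fromCommutativeRing R) homomorphism coefficient-≟ public
    using (solve; _:=_; _:+_; _:*_; :-_; _:-_; con; Polynomial)

module FieldProperties {q : ℕ} (F : FiniteField q) where
  open FiniteField F public using (0≢1; inverse)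

  commutativeRing : CommutativeRing 0ℓ 0ℓ
  commutativeRing = record { isCommutativeRing = FiniteField.isCommutativeRing F }

  open CommutativeRing commutativeRing public
    using (_+_; _*_; -_; _-_; 0#; 1#; *-identityʳ; zeroʳ; ring)
  open IntegerCoefficients commutativeRing public
  open import Algebra.Properties.Ring ring public using (-0#≈0#)
  open import Algebra.Properties.Ring ring using (x∙y⁻¹≈ε⇒x≈y; x≈y⇒x∙y⁻¹≈ε)
  open ≡.≡-Reasoning

  :0 :1 : ∀ {n} → Polynomial n
  :0 = con (+ 0)
  :1 = con (+ 1)

  1≢0 : 1# ≢ 0#
  1≢0 = 0≢1 ∘ ≡.sym

  x-y≡0⇒x≡y : ∀ {x y} → x - y ≡ 0# → x ≡ y
  x-y≡0⇒x≡y = x∙y⁻¹≈ε⇒x≈y _ _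

  x≡y⇒x-y≡0 : ∀ {x y} → x ≡ y → x - y ≡ 0#
  x≡y⇒x-y≡0 = x≈y⇒x∙y⁻¹≈ε

  _⁻¹[_] : (x : Fin q) → x ≢ 0# → Fin q
  x ⁻¹[ x≢0 ] = proj₁ (inverse x x≢0)

  *-inverseʳ : ∀ x (x≢0 : x ≢ 0#) → x * x ⁻¹[ x≢0 ] ≡ 1#
  *-inverseʳ x x≢0 = proj₂ (inverse x x≢0)

  x*y≡0⇒y≡0 : ∀ {x y} → x ≢ 0# → x * y ≡ 0# → y ≡ 0#
  x*y≡0⇒y≡0 {x} {y} x≢0 xy≡0 = begin
    y                       ≡⟨ solve 1 (λ y → y := y :* :1) ≡.refl y ⟩
    y * 1#                  ≡⟨ ≡.cong (y *_) (*-inverseʳ x x≢0) ⟨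
    y * (x * x ⁻¹[ x≢0 ])   ≡⟨ solve 3 (λ x y z → y :* (x :* z) := (x :* y) :* z) ≡.refl x y (x ⁻¹[ x≢0 ]) ⟩
    (x * y) * x ⁻¹[ x≢0 ]   ≡⟨ ≡.cong (_* x ⁻¹[ x≢0 ]) xy≡0 ⟩
    0# * x ⁻¹[ x≢0 ]        ≡⟨ solve 1 (λ z → :0 :* z := :0) ≡.refl (x ⁻¹[ x≢0 ]) ⟩
    0#                      ∎

  another : ∀ x → ∃[ y ] (y ≢ x)
  another x with x Fin.≟ 0#
  ... | yes ≡.refl = 1# , 1≢0
  ... | no x≢0     = 0# , x≢0 ∘ ≡.sym

  _/_[_] : Fin q → (y : Fin q) → y ≢ 0# → Fin q
  x / y [ y≢0 ] = x * y ⁻¹[ y≢0 ]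

  /-*-cancel : ∀ x {y} (y≢0 : y ≢ 0#) → x / y [ y≢0 ] * y ≡ x
  /-*-cancel x {y} y≢0 = begin
    x * y ⁻¹[ y≢0 ] * y       ≡⟨ solve 3 (λ x y z → x :* z :* y := x :* (y :* z)) ≡.refl x y (y ⁻¹[ y≢0 ]) ⟩
    x * (y * y ⁻¹[ y≢0 ])     ≡⟨ ≡.cong (x *_) (*-inverseʳ y y≢0) ⟩
    x * 1#                    ≡⟨ *-identityʳ x ⟩
    x                         ∎

module AffinePlaneProperties {q : ℕ} (F : FiniteField q) where
  open FieldProperties F
  open AffinePlane F public
  open ≡ using (refl; sym; trans; cong; cong₂; subst)
  open ≡.≡-Reasoning

  _≟ₚ_ : DecidableEquality Point
  _≟ₚ_ = ≡-dec Fin._≟_ Fin._≟_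

  _≟ₗ_ : DecidableEquality Line
  slope m b ≟ₗ slope m' b' with m Fin.≟ m' | b Fin.≟ b'
  ... | yes refl | yes refl = yes refl
  ... | no m≢m'  | _        = no λ { refl → m≢m' refl }
  ... | yes _    | no b≢b'  = no λ { refl → b≢b' refl }
  slope _ _ ≟ₗ vert _     = no λ ()
  vert _    ≟ₗ slope _ _  = no λ ()
  vert c    ≟ₗ vert c' with c Fin.≟ c'
  ... | yes refl = yes refl
  ... | no c≢c'  = no λ { refl → c≢c' refl }

  I-irrelevant : ∀ {z L} (h h' : z I L) → h ≡ h'
  I-irrelevant {L = slope _ _} = UIP.Decidable⇒UIP.≡-irrelevant Fin._≟_
  I-irrelevant {L = vert _}    = UIP.Decidable⇒UIP.≡-irrelevant Fin._≟_

  _-ₚ_ : Point → Point → Point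
  (a₁ , a₂) -ₚ (b₁ , b₂) = a₁ - b₁ , a₂ - b₂

  det : Point → Point → Fin q
  det (u₁ , u₂) (v₁ , v₂) = u₁ * v₂ - u₂ * v₁

  record Collinear (a b c : Point) : Set where
    constructor collinear
    field det≡0 : det (b -ₚ a) (c -ₚ a) ≡ 0#

  collinear-swap₁₂ : ∀ {a b c} → Collinear a b c → Collinear b a c
  collinear-swap₁₂ {a₁ , a₂} {b₁ , b₂} {c₁ , c₂} (collinear abc) = collinear $ begin
    (a₁ - b₁) * (c₂ - b₂) - (a₂ - b₂) * (c₁ - b₁)
      ≡⟨ solve 6 (λ a₁ a₂ b₁ b₂ c₁ c₂ →
           (a₁ :- b₁) :* (c₂ :- b₂) :- (a₂ :- b₂) :* (c₁ :- b₁)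
             := :- ((b₁ :- a₁) :* (c₂ :- a₂) :- (b₂ :- a₂) :* (c₁ :- a₁))) refl a₁ a₂ b₁ b₂ c₁ c₂ ⟩
    - ((b₁ - a₁) * (c₂ - a₂) - (b₂ - a₂) * (c₁ - a₁))
      ≡⟨ cong -_ abc ⟩
    - 0#
      ≡⟨ -0#≈0# ⟩
    0# ∎

  collinear-swap₂₃ : ∀ {a b c} → Collinear a b c → Collinear a c b
  collinear-swap₂₃ {a₁ , a₂} {b₁ , b₂} {c₁ , c₂} (collinear abc) = collinear $ begin
    (c₁ - a₁) * (b₂ - a₂) - (c₂ - a₂) * (b₁ - a₁)
      ≡⟨ solve 6 (λ a₁ a₂ b₁ b₂ c₁ c₂ →
           (c₁ :- a₁) :* (b₂ :- a₂) :- (c₂ :- a₂) :* (b₁ :- a₁)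
             := :- ((b₁ :- a₁) :* (c₂ :- a₂) :- (b₂ :- a₂) :* (c₁ :- a₁))) refl a₁ a₂ b₁ b₂ c₁ c₂ ⟩
    - ((b₁ - a₁) * (c₂ - a₂) - (b₂ - a₂) * (c₁ - a₁))
      ≡⟨ cong -_ abc ⟩
    - 0#
      ≡⟨ -0#≈0# ⟩
    0# ∎

  collinear-rotate : ∀ {a b c} → Collinear a b c → Collinear b c a
  collinear-rotate = collinear-swap₂₃ ∘ collinear-swap₁₂

  collinear-aab : ∀ a c → Collinear a a c
  collinear-aab (a₁ , a₂) (c₁ , c₂) = collinear $
    solve 4 (λ a₁ a₂ c₁ c₂ → (a₁ :- a₁) :* (c₂ :- a₂) :- (a₂ :- a₂) :* (c₁ :- a₁) := :0) refl a₁ a₂ c₁ c₂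

  collinear-aba : ∀ a b → Collinear a b a
  collinear-aba a b = collinear-swap₂₃ (collinear-aab a b)

  I⇒collinear : ∀ {a b z L} → a I L → b I L → z I L → Collinear a b z
  I⇒collinear {a₁ , _} {b₁ , _} {z₁ , _} {slope m β} refl refl refl = collinear $
    solve 5 (λ a₁ b₁ z₁ m β →
      (b₁ :- a₁) :* ((m :* z₁ :+ β) :- (m :* a₁ :+ β)) :- ((m :* b₁ :+ β) :- (m :* a₁ :+ β)) :* (z₁ :- a₁)
        := :0) refl a₁ b₁ z₁ m β
  I⇒collinear {a₁ , a₂} {_ , b₂} {_ , z₂} {vert _} refl refl refl = collinear $
    solve 4 (λ a₁ a₂ b₂ z₂ → (a₁ :- a₁) :* (z₂ :- a₂) :- (b₂ :- a₂) :* (a₁ :- a₁) := :0) refl a₁ a₂ b₂ z₂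

  collinear⇒I : ∀ {a b z L} → a ≢ b → a I L → b I L → Collinear a b z → z I L
  collinear⇒I {a₁ , _} {b₁ , _} {z₁ , z₂} {slope m β} a≢b refl refl (collinear abz) =
    x-y≡0⇒x≡y (x*y≡0⇒y≡0 b₁-a₁≢0 (trans (sym factor) abz))
    where
    b₁-a₁≢0 : b₁ - a₁ ≢ 0#
    b₁-a₁≢0 e = a≢b (cong (λ x → x , m * x + β) (sym (x-y≡0⇒x≡y e)))
    factor : (b₁ - a₁) * (z₂ - (m * a₁ + β)) - ((m * b₁ + β) - (m * a₁ + β)) * (z₁ - a₁)
           ≡ (b₁ - a₁) * (z₂ - (m * z₁ + β))
    factor = solve 6 (λ a₁ b₁ z₁ z₂ m β →
      (b₁ :- a₁) :* (z₂ :- (m :* a₁ :+ β)) :- ((m :* b₁ :+ β) :- (m :* a₁ :+ β)) :* (z₁ :- a₁)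
        := (b₁ :- a₁) :* (z₂ :- (m :* z₁ :+ β))) refl a₁ b₁ z₁ z₂ m β
  collinear⇒I {a₁ , a₂} {_ , b₂} {z₁ , z₂} {vert _} a≢b refl refl (collinear abz) =
    x-y≡0⇒x≡y (x*y≡0⇒y≡0 b₂-a₂≢0 (trans factor (trans (cong -_ abz) -0#≈0#)))
    where
    b₂-a₂≢0 : b₂ - a₂ ≢ 0#
    b₂-a₂≢0 e = a≢b (cong (a₁ ,_) (sym (x-y≡0⇒x≡y e)))
    factor : (b₂ - a₂) * (z₁ - a₁) ≡ - ((a₁ - a₁) * (z₂ - a₂) - (b₂ - a₂) * (z₁ - a₁))
    factor = solve 5 (λ a₁ a₂ b₂ z₁ z₂ →
      (b₂ :- a₂) :* (z₁ :- a₁) := :- ((a₁ :- a₁) :* (z₂ :- a₂) :- (b₂ :- a₂) :* (z₁ :- a₁))) refl a₁ a₂ b₂ z₁ z₂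

  slopeThrough : Fin q → Point → Line
  slopeThrough m (p₁ , p₂) = slope m (p₂ - m * p₁)

  slopeThrough-I : ∀ m p → p I slopeThrough m p
  slopeThrough-I m (p₁ , p₂) = solve 3 (λ m p₁ p₂ → p₂ := m :* p₁ :+ (p₂ :- m :* p₁)) refl m p₁ p₂

  join : Point → Point → Line
  join (a₁ , a₂) (b₁ , b₂) with a₁ Fin.≟ b₁
  ... | yes _    = vert a₁
  ... | no a₁≢b₁ = slopeThrough ((b₂ - a₂) / (b₁ - a₁) [ a₁≢b₁ ∘ sym ∘ x-y≡0⇒x≡y ]) (a₁ , a₂)

  join-I₁ : ∀ a b → a I join a b
  join-I₁ (a₁ , a₂) (b₁ , b₂) with a₁ Fin.≟ b₁
  ... | yes _ = refl
  ... | no _  = slopeThrough-I _ (a₁ , a₂)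

  join-I₂ : ∀ a b → b I join a b
  join-I₂ (a₁ , a₂) (b₁ , b₂) with a₁ Fin.≟ b₁
  ... | yes a₁≡b₁ = sym a₁≡b₁
  ... | no a₁≢b₁  = begin
    b₂                       ≡⟨ solve 2 (λ a₂ b₂ → b₂ := (b₂ :- a₂) :+ a₂) refl a₂ b₂ ⟩
    (b₂ - a₂) + a₂           ≡⟨ cong (_+ a₂) (/-*-cancel (b₂ - a₂) _) ⟨
    m * (b₁ - a₁) + a₂
      ≡⟨ solve 4 (λ a₁ a₂ b₁ m → m :* (b₁ :- a₁) :+ a₂ := m :* b₁ :+ (a₂ :- m :* a₁)) refl a₁ a₂ b₁ m ⟩
    m * b₁ + (a₂ - m * a₁)   ∎
    where
    m : Fin q
    m = (b₂ - a₂) / (b₁ - a₁) [ a₁≢b₁ ∘ sym ∘ x-y≡0⇒x≡y ]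

  line-ext : ∀ {L L'} → (∀ z → z I L → z I L') → L ≡ L'
  line-ext {slope m β} {slope m' β'} L⊆L' = cong₂ slope m≡m' β≡β'
    where
    β≡β' : β ≡ β'
    β≡β' = begin
      β              ≡⟨ solve 2 (λ m β → β := m :* :0 :+ β) refl m β ⟩
      m * 0# + β     ≡⟨ L⊆L' (0# , m * 0# + β) refl ⟩
      m' * 0# + β'   ≡⟨ solve 2 (λ m β → m :* :0 :+ β := β) refl m' β' ⟩
      β'             ∎
    m≡m' : m ≡ m'
    m≡m' = begin
      m                      ≡⟨ solve 2 (λ m β → m := (m :* :1 :+ β) :- β) refl m β ⟩
      (m * 1# + β) - β       ≡⟨ cong₂ _-_ (L⊆L' (1# , m * 1# + β) refl) β≡β' ⟩
      (m' * 1# + β') - β'    ≡⟨ solve 2 (λ m β → (m :* :1 :+ β) :- β := m) refl m' β' ⟩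
      m'                     ∎
  line-ext {slope m β} {vert c} L⊆L' =
    ⊥-elim (0≢1 (trans (L⊆L' (0# , m * 0# + β) refl) (sym (L⊆L' (1# , m * 1# + β) refl))))
  line-ext {vert c} {slope m' β'} L⊆L' =
    ⊥-elim (0≢1 (trans (L⊆L' (c , 0#) refl) (sym (L⊆L' (c , 1#) refl))))
  line-ext {vert c} {vert c'} L⊆L' = cong vert (L⊆L' (c , 0#) refl)

  unique-line : ∀ {a b L L'} → a ≢ b → a I L → b I L → a I L' → b I L' → L ≡ L'
  unique-line a≢b aL bL aL' bL' = line-ext λ z zL → collinear⇒I a≢b aL' bL' (I⇒collinear aL bL zL)

  ≡-join : ∀ {a b L} → a ≢ b → a I L → b I L → L ≡ join a b
  ≡-join {a} {b} a≢b aL bL = unique-line a≢b aL bL (join-I₁ a b) (join-I₂ a b)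

  I-join⇒collinear : ∀ {a b z} → z I join a b → Collinear a b z
  I-join⇒collinear {a} {b} = I⇒collinear (join-I₁ a b) (join-I₂ a b)

  collinear⇒I-join : ∀ {a b z} → a ≢ b → Collinear a b z → z I join a b
  collinear⇒I-join {a} {b} a≢b = collinear⇒I a≢b (join-I₁ a b) (join-I₂ a b)

  lines-meet-once : ∀ {L L' x y} → L ≢ L' → x I L → x I L' → y I L → y I L' → x ≡ y
  lines-meet-once {x = x} {y} L≢L' xL xL' yL yL' with x ≟ₚ y
  ... | yes x≡y = x≡y
  ... | no x≢y  = ⊥-elim (L≢L' (unique-line x≢y xL yL xL' yL'))

  pointOn : Line → Fin q → Point
  pointOn (slope m β) s = s , m * s + β
  pointOn (vert c)    s = c , s

  pointOn-I : ∀ L s → pointOn L s I L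
  pointOn-I (slope _ _) _ = refl
  pointOn-I (vert _)    _ = refl

  coordinateOn : Line → Point → Fin q
  coordinateOn (slope _ _) (x , _) = x
  coordinateOn (vert _)    (_ , y) = y

  pointOn-0≢1 : ∀ L → pointOn L 0# ≢ pointOn L 1#
  pointOn-0≢1 (slope _ _) = 0≢1 ∘ cong proj₁
  pointOn-0≢1 (vert _)    = 0≢1 ∘ cong proj₂

  pointOn-coordinate : ∀ L {s r} → pointOn L s ≡ r → s ≡ coordinateOn L r
  pointOn-coordinate (slope _ _) refl = refl
  pointOn-coordinate (vert _)    refl = refl

  another-point-on : ∀ L p → ∃[ x ] (x I L × x ≢ p)
  another-point-on L p with another (coordinateOn L p)
  ... | s , s≢ = pointOn L s , pointOn-I L s , s≢ ∘ pointOn-coordinate L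

  third-point-on : 2 ℕ.< q → ∀ L p p' → ∃[ x ] (x I L × x ≢ p × x ≢ p')
  third-point-on 2<q L p p' with avoid₂ 2<q (coordinateOn L p) (coordinateOn L p')
  ... | s , s≢ , s≢' = pointOn L s , pointOn-I L s , s≢ ∘ pointOn-coordinate L , s≢' ∘ pointOn-coordinate L

  fourth-point-on : 3 ℕ.< q → ∀ L p p' p'' → ∃[ x ] (x I L × x ≢ p × x ≢ p' × x ≢ p'')
  fourth-point-on 3<q L p p' p'' with avoid₃ 3<q (coordinateOn L p) (coordinateOn L p') (coordinateOn L p'')
  ... | s , s≢ , s≢' , s≢'' =
    pointOn L s , pointOn-I L s , s≢ ∘ pointOn-coordinate L , s≢' ∘ pointOn-coordinate L , s≢'' ∘ pointOn-coordinate L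

  point-off : ∀ L → ∃[ z ] (¬ z I L)
  point-off (slope m β) = (0# , β + 1#) , λ e →
    1≢0 (trans (solve 3 (λ m β one → one := (β :+ one) :- (m :* :0 :+ β)) refl m β 1#) (x≡y⇒x-y≡0 e))
  point-off (vert c)    = (c + 1# , 0#) , λ e →
    1≢0 (trans (solve 2 (λ c one → one := (c :+ one) :- c) refl c 1#) (x≡y⇒x-y≡0 e))

  -- Vertical lines get gradient 0#, so gradient L ≢ m still forces L to meet every line of slope m.
  gradient : Line → Fin q
  gradient (slope m _) = m
  gradient (vert _)    = 0#

  ≢-gradient⇒≢ : ∀ {L L'} → gradient L ≢ gradient L' → L ≢ L'
  ≢-gradient⇒≢ g≢g' L≡L' = g≢g' (cong gradient L≡L')

  slope-meets : ∀ m β L → gradient L ≢ m → ∃[ u ] (u I slope m β × u I L)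
  slope-meets m β (vert c)     _    = (c , m * c + β) , refl , refl
  slope-meets m β (slope m' β') m'≢m = (x , m * x + β) , refl , (begin
    m * x + β                   ≡⟨ solve 4 (λ m m' β x → m :* x :+ β := x :* (m :- m') :+ (m' :* x :+ β)) refl m m' β x ⟩
    x * (m - m') + (m' * x + β) ≡⟨ cong (_+ (m' * x + β)) (/-*-cancel (β' - β) m-m'≢0) ⟩
    (β' - β) + (m' * x + β)     ≡⟨ solve 4 (λ m' β β' x → (β' :- β) :+ (m' :* x :+ β) := m' :* x :+ β') refl m' β β' x ⟩
    m' * x + β'                 ∎)
    where
    m-m'≢0 : m - m' ≢ 0#
    m-m'≢0 e = m'≢m (sym (x-y≡0⇒x≡y e))
    x : Fin q
    x = (β' - β) / (m - m') [ m-m'≢0 ]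

  line-avoiding : 2 ℕ.< q → ∀ p L₁ L₂ → ∃[ N ] (p I N × N ≢ L₁ × N ≢ L₂)
  line-avoiding 2<q p L₁ L₂ with avoid₂ 2<q (gradient L₁) (gradient L₂)
  ... | m , m≢₁ , m≢₂ = slopeThrough m p , slopeThrough-I m p , ≢-gradient⇒≢ m≢₁ , ≢-gradient⇒≢ m≢₂

module IncSysProperties {n : ℕ} (Γ : IncSys n) where
  open IncSys Γ
  open IncSysNotions Γ
  open ≡ using (refl; sym; trans; subst₂)

  full-flag-chamber : ∀ (F : Flag) → (∀ i → ∃[ x ] (el F i ≡ just x)) → ∃[ C ] (F ⊆C C)
  full-flag-chamber F full = C , λ i x e → just-injective (trans (sym (proj₂ (full i))) e)
    where
    C : Chamber
    C = record
      { ch     = proj₁ ∘ full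
      ; ctyped = λ i → typed F i _ (proj₂ (full i))
      ; cinc   = λ i j → pairwise F i j _ _ (proj₂ (full i)) (proj₂ (full j)) }


  PreservesInc-inverse : (φ : X ↔ X) → PreservesInc φ → PreservesInc (↔-sym φ)
  PreservesInc-inverse φ preserves x y =
      (λ x∗y → proj₂ (preserves (from x) (from y)) (subst₂ _∗_ (sym (strictlyInverseˡ x)) (sym (strictlyInverseˡ y)) x∗y))
    , (λ fx∗fy → subst₂ _∗_ (strictlyInverseˡ x) (strictlyInverseˡ y) (proj₁ (preserves (from x) (from y)) fx∗fy))
    where open Inverse φ

  CommonNeighbour : Fin n → X → X → Set
  CommonNeighbour i x y = ∃[ z ] (typ z ≡ i × x ∗ z × y ∗ z)

  Linked : Fin n → Fin n → X → X → Set
  Linked o k x y = x ≢ y × CommonNeighbour o x y × ¬ CommonNeighbour k x y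

  Linked-transport : ∀ (φ : X ↔ X) → PreservesInc φ → ∀ {o k o' k' x y} →
    (∀ z → typ z ≡ o → typ (Inverse.to φ z) ≡ o') →
    (∀ z → typ z ≡ k' → typ (Inverse.from φ z) ≡ k) →
    Linked o k x y → Linked o' k' (Inverse.to φ x) (Inverse.to φ y)
  Linked-transport φ preserves {x = x} {y} o↦o' k'↦k (x≢y , (z , z:o , x∗z , y∗z) , ¬common) =
      x≢y ∘ Injection.injective (↔⇒↣ φ)
    , (to z , o↦o' z z:o , proj₁ (preserves x z) x∗z , proj₁ (preserves y z) y∗z)
    , λ (w , w:k' , φx∗w , φy∗w) → ¬common (from w , k'↦k w w:k' , reflect x φx∗w , reflect y φy∗w)
    where
    open Inverse φ
    reflect : ∀ a {w} → to a ∗ w → a ∗ from w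
    reflect a {w} φa∗w = proj₂ (preserves a (from w)) (subst₂ _∗_ refl (sym (strictlyInverseˡ w)) φa∗w)

module TriangleComplexProperties {P L : Set} (_I_ : P → L → Set) where
  open TriangleComplex _I_ public
  open IncSysNotions Δ public
  open ≡ using (refl; sym; trans; cong)

  ∗-sym : ∀ {a b} → a ∗ b → b ∗ a
  ∗-sym (inj₁ refl)      = inj₁ refl
  ∗-sym (inj₂ (inj₁ ab)) = inj₂ (inj₂ ab)
  ∗-sym (inj₂ (inj₂ ba)) = inj₂ (inj₁ ba)

  meet-unique : ∀ {ℓ ℓ' p x} → MeetExactly ℓ ℓ' p → x I ℓ → x I ℓ' → x ≡ p
  meet-unique meet xℓ xℓ' = proj₁ (meet _) (xℓ , xℓ')

  meet-I₁ : ∀ {ℓ ℓ' p} → MeetExactly ℓ ℓ' p → p I ℓ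
  meet-I₁ {p = p} meet = proj₁ (proj₂ (meet p) refl)

  meet-I₂ : ∀ {ℓ ℓ' p} → MeetExactly ℓ ℓ' p → p I ℓ'
  meet-I₂ {p = p} meet = proj₂ (proj₂ (meet p) refl)

  -- Adj as a record, so that its two elements can be inferred by unification.
  record Adjacent (a b : Elem) : Set where
    constructor adjacent
    field
      ty-next : ty b ≡ next (ty a)
      meets   : MeetExactly (ln a) (ln b) (pt a)
      pt≢     : pt a ≢ pt b

    pt-I : pt a I ln b
    pt-I = meet-I₂ meets

  Adjacent⇒∗ : ∀ {a b} → Adjacent a b → a ∗ b
  Adjacent⇒∗ (adjacent ty-next meets pt≢) = inj₂ (inj₁ (ty-next , meets , pt≢))

  Adjacent⇒∗˘ : ∀ {a b} → Adjacent b a → a ∗ b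
  Adjacent⇒∗˘ (adjacent ty-next meets pt≢) = inj₂ (inj₂ (ty-next , meets , pt≢))

  ∗⇒Adjacent : ∀ {a b t} → ty a ≡ t → ty b ≡ next t → a ∗ b → Adjacent a b
  ∗⇒Adjacent {t = t} refl b:next (inj₁ refl) = contradiction (sym b:next) (next≢id t)
  ∗⇒Adjacent _ _ (inj₂ (inj₁ (ty-next , meets , pt≢))) = adjacent ty-next meets pt≢
  ∗⇒Adjacent {t = t} refl b:next (inj₂ (inj₂ (a:next , _))) =
    contradiction (sym (trans a:next (cong next b:next))) (prev≢id t)

  preservesInc-from-Adj : ∀ (φ : Elem ↔ Elem) → let open Inverse φ in
    (∀ {a b} → Adj a b → Adj (to a) (to b)) → (∀ {a b} → Adj (to a) (to b) → Adj a b) → PreservesInc φ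
  preservesInc-from-Adj φ preserves reflects x y = preserve , reflect
    where
    open Inverse φ
    preserve : x ∗ y → to x ∗ to y
    preserve (inj₁ refl)      = inj₁ refl
    preserve (inj₂ (inj₁ xy)) = inj₂ (inj₁ (preserves {x} {y} xy))
    preserve (inj₂ (inj₂ yx)) = inj₂ (inj₂ (preserves {y} {x} yx))
    reflect : to x ∗ to y → x ∗ y
    reflect (inj₁ e)          = inj₁ (Injection.injective (↔⇒↣ φ) e)
    reflect (inj₂ (inj₁ xy)) = inj₂ (inj₁ (reflects {x} {y} xy))
    reflect (inj₂ (inj₂ yx)) = inj₂ (inj₂ (reflects {y} {x} yx))

  shift unshift : Elem → Elem
  shift   (elem p ℓ h i) = elem p ℓ h (next i)
  unshift (elem p ℓ h i) = elem p ℓ h (prev i)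

  shift³ : ∀ x → shift (shift (shift x)) ≡ x
  shift³ (elem p ℓ h i) = cong (elem p ℓ h) (next³ i)

  shift↔ : Elem ↔ Elem
  shift↔ = mk↔ₛ′ shift unshift (λ { (elem p ℓ h i) → cong (elem p ℓ h) (next³ i) })
                               (λ { (elem p ℓ h i) → cong (elem p ℓ h) (next³ i) })

  shift-preservesInc : PreservesInc shift↔
  shift-preservesInc = preservesInc-from-Adj shift↔
    (λ (b:next , meet , p≢) → cong next b:next , meet , p≢)
    (λ (b:next , meet , p≢) → next-injective b:next , meet , p≢)

  next-is-3-cycle : Is3Cycle next
  next-is-3-cycle = zero , suc zero , suc (suc zero) , (λ ()) , (λ ()) , (λ ()) , refl , refl , refl , fixes
    where
    fixes : ∀ l → l ≢ zero → l ≢ suc zero → l ≢ suc (suc zero) → next l ≡ l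
    fixes zero             ≢0 _  _  = contradiction refl ≢0
    fixes (suc zero)       _  ≢1 _  = contradiction refl ≢1
    fixes (suc (suc zero)) _  _  ≢2 = contradiction refl ≢2

  triality : Elem → AdmitsTriality
  triality x =
    shiftCorrelation , (shift³ , λ all-fixed → next≢id (ty x) (cong ty (all-fixed x))) , next , (λ _ → refl) , next-is-3-cycle
    where
    shiftCorrelation : Correlation
    shiftCorrelation = record { φ = shift↔ ; inc = shift-preservesInc ; typeRes = λ _ _ → cong next }


module TriangleComplexOfAG {q : ℕ} (F : FiniteField q) where
  open FieldProperties F
  open AffinePlaneProperties F public
  open TriangleComplexProperties _I_ public
  open ≡ using (refl; sym; trans; cong; subst)

  elem-≡ : ∀ {a b} → pt a ≡ pt b → ln a ≡ ln b → ty a ≡ ty b → a ≡ b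
  elem-≡ {elem p L h i} {elem _ _ h' _} refl refl refl = cong (λ h → elem p L h i) (I-irrelevant h h')

  meet-intro : ∀ {L L' p} → L ≢ L' → p I L → p I L' → MeetExactly L L' p
  meet-intro L≢L' pL pL' x = (λ (xL , xL') → lines-meet-once L≢L' xL xL' pL pL') , λ { refl → pL , pL' }

  meet⇒≢ : ∀ {L L' p} → MeetExactly L L' p → L ≢ L'
  meet⇒≢ {L} {p = p} meet refl with another-point-on L p
  ... | x , xL , x≢p = x≢p (meet-unique meet xL xL)

  adjacent-intro : ∀ {a b} → ty b ≡ next (ty a) → ln a ≢ ln b → pt a I ln b → pt a ≢ pt b → Adjacent a b
  adjacent-intro {a} b:next La≢Lb a∈Lb a≢b = adjacent b:next (meet-intro La≢Lb (inc a) a∈Lb) a≢b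

  origin-on-y-axis : Elem
  origin-on-y-axis = elem (0# , 0#) (vert 0#) refl zero

  corner : Point → Point → Fin 3 → Elem
  corner a c t = elem a (join a c) (join-I₁ a c) t

  corner-unique : ∀ {x b t} → pt x ≢ b → b I ln x → ty x ≡ t → corner (pt x) b t ≡ x
  corner-unique {x} x≢b b∈x x:t = elem-≡ refl (sym (≡-join x≢b (inc x) b∈x)) (sym x:t)

  corner-adjacent : ∀ {a b c} t → ¬ Collinear a c b → Adjacent (corner a c t) (corner b a (next t))
  corner-adjacent {a} {b} {c} t ¬acb = adjacent-intro refl sides-differ (join-I₂ b a) a≢b
    where
    a≢b : a ≢ b
    a≢b refl = ¬acb (collinear-aba a c)
    sides-differ : join a c ≢ join b a
    sides-differ e = ¬acb (I-join⇒collinear (subst (b I_) (sym e) (join-I₁ b a)))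

  Triangle : Set
  Triangle = Fin 3 → Point

  NonCollinear : Triangle → Set
  NonCollinear v = ¬ Collinear (v zero) (v (suc zero)) (v (suc (suc zero)))

  nonCollinear-at : ∀ v → NonCollinear v → ∀ t → ¬ Collinear (v t) (v (next t)) (v (prev t))
  nonCollinear-at v nc zero             = nc
  nonCollinear-at v nc (suc zero)       = nc ∘ collinear-rotate ∘ collinear-rotate
  nonCollinear-at v nc (suc (suc zero)) = nc ∘ collinear-rotate

  triangleElem : Triangle → Fin 3 → Elem
  triangleElem v i = corner (v i) (v (prev i)) i

  triangle-adjacent : ∀ v → NonCollinear v → ∀ i → Adjacent (triangleElem v i) (triangleElem v (next i))
  triangle-adjacent v nc zero             = corner-adjacent zero             (nonCollinear-at v nc zero ∘ collinear-swap₂₃)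
  triangle-adjacent v nc (suc zero)       = corner-adjacent (suc zero)       (nonCollinear-at v nc (suc zero) ∘ collinear-swap₂₃)
  triangle-adjacent v nc (suc (suc zero)) = corner-adjacent (suc (suc zero)) (nonCollinear-at v nc (suc (suc zero)) ∘ collinear-swap₂₃)

  triangleChamber : (v : Triangle) → NonCollinear v → Chamber
  triangleChamber v nc = record { ch = triangleElem v ; ctyped = λ _ → refl ; cinc = incident }
    where
    incident : ∀ i j → triangleElem v i ∗ triangleElem v j
    incident i j with next-cases j i
    ... | inj₁ refl        = inj₁ refl
    ... | inj₂ (inj₁ refl) = Adjacent⇒∗ (triangle-adjacent v nc i)
    ... | inj₂ (inj₂ refl) =
      Adjacent⇒∗˘ (subst (λ k → Adjacent (triangleElem v (prev i)) (triangleElem v k)) (next³ i) (triangle-adjacent v nc (prev i)))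

  vertices : Chamber → Triangle
  vertices C i = pt (ch C i)

  chamber-adjacent : ∀ C i → Adjacent (ch C i) (ch C (next i))
  chamber-adjacent C i = ∗⇒Adjacent (ctyped C i) (ctyped C (next i)) (cinc C i (next i))

  chamber-adjacent-prev : ∀ C i → Adjacent (ch C (prev i)) (ch C i)
  chamber-adjacent-prev C i = ∗⇒Adjacent (ctyped C (prev i)) (trans (ctyped C i) (sym (next³ i))) (cinc C (prev i) i)

  chamber-nonCollinear-at : ∀ C t → ¬ Collinear (vertices C t) (vertices C (next t)) (vertices C (prev t))
  chamber-nonCollinear-at C t abc = Adjacent.pt≢ bc (sym (meet-unique (Adjacent.meets bc) c∈Lb (inc (ch C (prev t)))))
    where
    ab : Adjacent (ch C t) (ch C (next t))
    ab = chamber-adjacent C t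
    bc : Adjacent (ch C (next t)) (ch C (prev t))
    bc = chamber-adjacent C (next t)
    c∈Lb : vertices C (prev t) I ln (ch C (next t))
    c∈Lb = collinear⇒I (Adjacent.pt≢ ab) (Adjacent.pt-I ab) (inc (ch C (next t))) abc

  chamber-nonCollinear : ∀ C → NonCollinear (vertices C)
  chamber-nonCollinear C = chamber-nonCollinear-at C zero

  chamber-≡-triangle : ∀ C i → ch C i ≡ triangleElem (vertices C) i
  chamber-≡-triangle C i = sym (corner-unique (Adjacent.pt≢ ca ∘ sym) (Adjacent.pt-I ca) (ctyped C i))
    where
    ca : Adjacent (ch C (prev i)) (ch C i)
    ca = chamber-adjacent-prev C i

module GeometryOfΔ {q : ℕ} (F : FiniteField q) where
  open FieldProperties F
  open TriangleComplexOfAG F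
  open IncSysProperties Δ using (full-flag-chamber)
  open ≡ using (refl; sym; trans; cong; subst)

  triangleAt : Fin 3 → Point → Point → Point → Triangle
  triangleAt zero             a b c zero             = a
  triangleAt zero             a b c (suc zero)       = b
  triangleAt zero             a b c (suc (suc zero)) = c
  triangleAt (suc zero)       a b c zero             = c
  triangleAt (suc zero)       a b c (suc zero)       = a
  triangleAt (suc zero)       a b c (suc (suc zero)) = b
  triangleAt (suc (suc zero)) a b c zero             = b
  triangleAt (suc (suc zero)) a b c (suc zero)       = c
  triangleAt (suc (suc zero)) a b c (suc (suc zero)) = a

  triangleAt-nonCollinear : ∀ t {a b c} → ¬ Collinear a b c → NonCollinear (triangleAt t a b c)
  triangleAt-nonCollinear zero             ¬abc = ¬abc
  triangleAt-nonCollinear (suc zero)       ¬abc = ¬abc ∘ collinear-rotate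
  triangleAt-nonCollinear (suc (suc zero)) ¬abc = ¬abc ∘ collinear-rotate ∘ collinear-rotate

  chamberAt : ∀ t a b c → ¬ Collinear a b c → Chamber
  chamberAt t a b c ¬abc = triangleChamber (triangleAt t a b c) (triangleAt-nonCollinear t ¬abc)

  chamberAt-at : ∀ t {a b c} (¬abc : ¬ Collinear a b c) → ch (chamberAt t a b c ¬abc) t ≡ corner a c t
  chamberAt-at zero             _ = refl
  chamberAt-at (suc zero)       _ = refl
  chamberAt-at (suc (suc zero)) _ = refl

  chamberAt-next : ∀ t {a b c} (¬abc : ¬ Collinear a b c) → ch (chamberAt t a b c ¬abc) (next t) ≡ corner b a (next t)
  chamberAt-next zero             _ = refl
  chamberAt-next (suc zero)       _ = refl
  chamberAt-next (suc (suc zero)) _ = refl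

  chamberAt-prev : ∀ t {a b c} (¬abc : ¬ Collinear a b c) → ch (chamberAt t a b c ¬abc) (prev t) ≡ corner c b (prev t)
  chamberAt-prev zero             _ = refl
  chamberAt-prev (suc zero)       _ = refl
  chamberAt-prev (suc (suc zero)) _ = refl

  chamber-through : ∀ a → ∃[ C ] (ch C (ty a) ≡ a)
  chamber-through a with another-point-on (ln a) (pt a) | point-off (ln a)
  ... | r , r∈a , r≢a | z , z∉a =
    chamberAt (ty a) (pt a) z r ¬azr ,
    trans (chamberAt-at (ty a) ¬azr) (corner-unique (r≢a ∘ sym) r∈a refl)
    where
    ¬azr : ¬ Collinear (pt a) z r
    ¬azr azr = z∉a (collinear⇒I (r≢a ∘ sym) (inc a) r∈a (collinear-swap₂₃ azr))

  chamber-through-adjacent : ∀ {a b} → Adjacent a b → ∃[ C ] (ch C (ty a) ≡ a × ch C (ty b) ≡ b)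
  chamber-through-adjacent {a} {b} ab with another-point-on (ln a) (pt a)
  ... | r , r∈a , r≢a =
    C , trans (chamberAt-at (ty a) ¬abr) (corner-unique (r≢a ∘ sym) r∈a refl)
      , subst (λ i → ch C i ≡ b) (sym (Adjacent.ty-next ab))
          (trans (chamberAt-next (ty a) ¬abr) (corner-unique (Adjacent.pt≢ ab ∘ sym) (Adjacent.pt-I ab) (Adjacent.ty-next ab)))
    where
    ¬abr : ¬ Collinear (pt a) (pt b) r
    ¬abr abr = r≢a (meet-unique (Adjacent.meets ab) r∈a (collinear⇒I (Adjacent.pt≢ ab) (Adjacent.pt-I ab) (inc b) abr))
    C : Chamber
    C = chamberAt (ty a) (pt a) (pt b) r ¬abr

  ⊆C-intro : ∀ (F : Flag) (C : Chamber) t → el F t ≡ nothing →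
             (∀ x → el F (next t) ≡ just x → ch C (next t) ≡ x) →
             (∀ x → el F (prev t) ≡ just x → ch C (prev t) ≡ x) → F ⊆C C
  ⊆C-intro F C t F-t at-next at-prev i x Fi≡x with next-cases i t
  ... | inj₁ refl        = contradiction (trans (sym F-t) Fi≡x) λ ()
  ... | inj₂ (inj₁ refl) = at-next x Fi≡x
  ... | inj₂ (inj₂ refl) = at-prev x Fi≡x

  matched : ∀ (F : Flag) (C : Chamber) {i a} → el F i ≡ just a → ch C (ty a) ≡ a →
            ∀ x → el F i ≡ just x → ch C i ≡ x
  matched F C {i} {a} Fi≡a C∋a x Fi≡x =
    ≡.subst₂ (λ j y → ch C j ≡ y) (typed F i a Fi≡a) (just-injective (trans (sym Fi≡a) Fi≡x)) C∋a

  vacuous : ∀ (F : Flag) (C : Chamber) {i} → el F i ≡ nothing → ∀ x → el F i ≡ just x → ch C i ≡ x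
  vacuous F C Fi≡nothing x Fi≡x = contradiction (trans (sym Fi≡nothing) Fi≡x) λ ()

  flag-missing-in-chamber : ∀ (F : Flag) t → el F t ≡ nothing → ∃[ C ] (F ⊆C C)
  flag-missing-in-chamber F t F-t with el F (next t) in Fn | el F (prev t) in Fp
  ... | just a  | just b  =
    let C , C∋a , C∋b = chamber-through-adjacent (∗⇒Adjacent (typed F _ a Fn) (typed F _ b Fp) (pairwise F _ _ a b Fn Fp))
    in C , ⊆C-intro F C t F-t (matched F C Fn C∋a) (matched F C Fp C∋b)
  ... | just a  | nothing =
    let C , C∋a = chamber-through a in C , ⊆C-intro F C t F-t (matched F C Fn C∋a) (vacuous F C Fp)
  ... | nothing | just b  =
    let C , C∋b = chamber-through b in C , ⊆C-intro F C t F-t (vacuous F C Fn) (matched F C Fp C∋b)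
  ... | nothing | nothing =
    let C , _ = chamber-through origin-on-y-axis in C , ⊆C-intro F C t F-t (vacuous F C Fn) (vacuous F C Fp)

  geometry : IsGeometry
  geometry F with el F zero in F₀ | el F (suc zero) in F₁ | el F (suc (suc zero)) in F₂
  ... | nothing | _       | _       = flag-missing-in-chamber F zero F₀
  ... | just _  | nothing | _       = flag-missing-in-chamber F (suc zero) F₁
  ... | just _  | just _  | nothing = flag-missing-in-chamber F (suc (suc zero)) F₂
  ... | just x₀ | just x₁ | just x₂ = full-flag-chamber F λ
    { zero → x₀ , F₀ ; (suc zero) → x₁ , F₁ ; (suc (suc zero)) → x₂ , F₂ }

  module VertexReplacement (C : Chamber) (t : Fin 3) where
    B D : Point
    B = vertices C (next t)
    D = vertices C (prev t)
    L : Line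
    L = ln (ch C (next t))

    ¬collinear : ∀ {a} → a I L → a ≢ B → ¬ Collinear a B D
    ¬collinear {a} a∈L a≢B aBD = chamber-nonCollinear-at C t (I⇒collinear A∈L (inc (ch C (next t))) D∈L)
      where
      A∈L : vertices C t I L
      A∈L = Adjacent.pt-I (chamber-adjacent C t)
      D∈L : D I L
      D∈L = collinear⇒I a≢B a∈L (inc (ch C (next t))) aBD

    replace : ∀ a → a I L → a ≢ B → Chamber
    replace a a∈L a≢B = chamberAt t a B D (¬collinear a∈L a≢B)

    replace-at : ∀ {a} (a∈L : a I L) (a≢B : a ≢ B) → pt (ch (replace a a∈L a≢B) t) ≡ a
    replace-at a∈L a≢B = cong pt (chamberAt-at t (¬collinear a∈L a≢B))

    replace-next : ∀ {a} (a∈L : a I L) (a≢B : a ≢ B) → ch (replace a a∈L a≢B) (next t) ≡ ch C (next t)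
    replace-next a∈L a≢B =
      trans (chamberAt-next t (¬collinear a∈L a≢B)) (corner-unique (a≢B ∘ sym) a∈L (ctyped C (next t)))

    replace-prev : ∀ {a} (a∈L : a I L) (a≢B : a ≢ B) → ch (replace a a∈L a≢B) (prev t) ≡ ch C (prev t)
    replace-prev a∈L a≢B =
      trans (chamberAt-prev t (¬collinear a∈L a≢B)) (corner-unique (Adjacent.pt≢ BD ∘ sym) (Adjacent.pt-I BD) (ctyped C (prev t)))
      where
      BD : Adjacent (ch C (next t)) (ch C (prev t))
      BD = chamber-adjacent C (next t)

    replace-⊆C : ∀ (F : Flag) → el F t ≡ nothing → F ⊆C C →
                 ∀ {a} (a∈L : a I L) (a≢B : a ≢ B) → F ⊆C replace a a∈L a≢B
    replace-⊆C F F-t F⊆C {a} a∈L a≢B = ⊆C-intro F (replace a a∈L a≢B) t F-t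
      (λ x e → trans (replace-next a∈L a≢B) (F⊆C _ x e))
      (λ x e → trans (replace-prev a∈L a≢B) (F⊆C _ x e))

    replace-≢C : ∀ {a a'} (a∈L : a I L) (a≢B : a ≢ B) (a'∈L : a' I L) (a'≢B : a' ≢ B) → a ≢ a' →
                 replace a a∈L a≢B ≢C replace a' a'∈L a'≢B
    replace-≢C a∈L a≢B a'∈L a'≢B a≢a' same =
      a≢a' (trans (sym (replace-at a∈L a≢B)) (trans (cong pt (same t)) (replace-at a'∈L a'≢B)))

  thick : 3 ℕ.< q → Thick
  thick 3<q F (t , F-t) with geometry F
  ... | C , F⊆C with another-point-on (ln (ch C (next t))) (vertices C (next t))
  ... | x₁ , x₁∈L , x₁≢B with third-point-on (ℕ.<⇒≤ 3<q) (ln (ch C (next t))) (vertices C (next t)) x₁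
  ... | x₂ , x₂∈L , x₂≢B , x₂≢x₁ with fourth-point-on 3<q (ln (ch C (next t))) (vertices C (next t)) x₁ x₂
  ... | x₃ , x₃∈L , x₃≢B , x₃≢x₁ , x₃≢x₂ =
      replace x₁ x₁∈L x₁≢B , replace x₂ x₂∈L x₂≢B , replace x₃ x₃∈L x₃≢B
    , replace-⊆C F F-t F⊆C x₁∈L x₁≢B , replace-⊆C F F-t F⊆C x₂∈L x₂≢B , replace-⊆C F F-t F⊆C x₃∈L x₃≢B
    , replace-≢C x₁∈L x₁≢B x₂∈L x₂≢B (x₂≢x₁ ∘ sym)
    , replace-≢C x₁∈L x₁≢B x₃∈L x₃≢B (x₃≢x₁ ∘ sym)
    , replace-≢C x₂∈L x₂≢B x₃∈L x₃≢B (x₃≢x₂ ∘ sym)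
    where open VertexReplacement C t

module Collineations {q : ℕ} (F : FiniteField q) where
  open FieldProperties F
  open TriangleComplexOfAG F
  open ≡ using (refl; sym; trans; cong; cong₂; subst)
  open ≡.≡-Reasoning

  collinear-cong : ∀ {a b c a' b' c'} → a ≡ a' → b ≡ b' → c ≡ c' → Collinear a b c → Collinear a' b' c'
  collinear-cong refl refl refl abc = abc

  record Collineation : Set where
    field
      bijection : Point ↔ Point
    open Inverse bijection public using (to; from; strictlyInverseˡ; strictlyInverseʳ)
    field
      preserves : ∀ {a b c} → Collinear a b c → Collinear (to a) (to b) (to c)
      reflects  : ∀ {a b c} → Collinear (to a) (to b) (to c) → Collinear a b c

    to-injective : ∀ {a b} → to a ≡ to b → a ≡ b
    to-injective = Injection.injective (↔⇒↣ bijection)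

  _⁻¹ᶜ : Collineation → Collineation
  f ⁻¹ᶜ = record
    { bijection = ↔-sym bijection
    ; preserves = λ abc →
        reflects (collinear-cong (sym (strictlyInverseˡ _)) (sym (strictlyInverseˡ _)) (sym (strictlyInverseˡ _)) abc)
    ; reflects  = λ abc → collinear-cong (strictlyInverseˡ _) (strictlyInverseˡ _) (strictlyInverseˡ _) (preserves abc)
    }
    where open Collineation f

  _∘ᶜ_ : Collineation → Collineation → Collineation
  g ∘ᶜ f = record
    { bijection = Collineation.bijection g ↔-∘ Collineation.bijection f
    ; preserves = Collineation.preserves g ∘ Collineation.preserves f
    ; reflects  = Collineation.reflects f ∘ Collineation.reflects g
    }

  module Induced (f : Collineation) where
    open Collineation f

    lineImage : Line → Line
    lineImage L = join (to (pointOn L 0#)) (to (pointOn L 1#))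

    I⇒I-image : ∀ {z L} → z I L → to z I lineImage L
    I⇒I-image {z} {L} zL = collinear⇒I-join (pointOn-0≢1 L ∘ to-injective)
      (preserves (I⇒collinear (pointOn-I L 0#) (pointOn-I L 1#) zL))

    I-image⇒I : ∀ {z L} → to z I lineImage L → z I L
    I-image⇒I {z} {L} zL = collinear⇒I (pointOn-0≢1 L) (pointOn-I L 0#) (pointOn-I L 1#) (reflects (I-join⇒collinear zL))

    lineImage-join : ∀ {a b} → a ≢ b → lineImage (join a b) ≡ join (to a) (to b)
    lineImage-join {a} {b} a≢b = ≡-join (a≢b ∘ to-injective) (I⇒I-image (join-I₁ a b)) (I⇒I-image (join-I₂ a b))

    lineImage-injective : ∀ {L L'} → lineImage L ≡ lineImage L' → L ≡ L'
    lineImage-injective e = line-ext λ z zL → I-image⇒I (subst (to z I_) e (I⇒I-image zL))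

    meet-image : ∀ {L L' p} → MeetExactly L L' p → MeetExactly (lineImage L) (lineImage L') (to p)
    meet-image {L} {L'} meet =
      meet-intro (meet⇒≢ meet ∘ lineImage-injective) (I⇒I-image (meet-I₁ {L} {L'} meet)) (I⇒I-image (meet-I₂ {L} {L'} meet))

    meet-preimage : ∀ {L L' p} → MeetExactly (lineImage L) (lineImage L') (to p) → MeetExactly L L' p
    meet-preimage {L} {L'} meet =
      meet-intro (meet⇒≢ meet ∘ cong lineImage) (I-image⇒I (meet-I₁ {lineImage L} {lineImage L'} meet))
                 (I-image⇒I (meet-I₂ {lineImage L} {lineImage L'} meet))

    elemImage : Elem → Elem
    elemImage x = elem (to (pt x)) (lineImage (ln x)) (I⇒I-image (inc x)) (ty x)

    Adj-image : ∀ {a b} → Adj a b → Adj (elemImage a) (elemImage b)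
    Adj-image (b:next , meet , p≢) = b:next , meet-image meet , p≢ ∘ to-injective

    Adj-preimage : ∀ {a b} → Adj (elemImage a) (elemImage b) → Adj a b
    Adj-preimage (b:next , meet , p≢) = b:next , meet-preimage meet , p≢ ∘ cong to

    elemImage-corner : ∀ {a c} t → a ≢ c → elemImage (corner a c t) ≡ corner (to a) (to c) t
    elemImage-corner t a≢c = elem-≡ refl (lineImage-join a≢c) refl

  elemImage-cancel : ∀ {f g : Collineation} → (∀ z → Collineation.to g (Collineation.to f z) ≡ z) →
                     ∀ x → Induced.elemImage g (Induced.elemImage f x) ≡ x
  elemImage-cancel {f} {g} gf x = elem-≡ (gf (pt x)) (line-ext λ z z∈ →
    Induced.I-image⇒I f (Induced.I-image⇒I g (subst (_I _) (sym (gf z)) z∈))) refl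

  automorphism : Collineation → Automorphism
  automorphism f = record
    { φ        = φ
    ; inc      = preservesInc-from-Adj φ (λ {a} {b} → Induced.Adj-image f {a} {b}) (λ {a} {b} → Induced.Adj-preimage f {a} {b})
    ; typePres = λ _ → refl
    }
    where
    φ : Elem ↔ Elem
    φ = mk↔ₛ′ (Induced.elemImage f) (Induced.elemImage (f ⁻¹ᶜ))
              (elemImage-cancel {f ⁻¹ᶜ} {f} (Collineation.strictlyInverseˡ f))
              (elemImage-cancel {f} {f ⁻¹ᶜ} (Collineation.strictlyInverseʳ f))

  module AffineMap (o u v : Point) (det≢0 : det u v ≢ 0#) where
    private
      o₁ o₂ u₁ u₂ v₁ v₂ δ : Fin q
      o₁ = proj₁ o
      o₂ = proj₂ o
      u₁ = proj₁ u
      u₂ = proj₂ u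
      v₁ = proj₁ v
      v₂ = proj₂ v
      δ = det u v ⁻¹[ det≢0 ]
      δ-inverse : (u₁ * v₂ - u₂ * v₁) * δ ≡ 1#
      δ-inverse = *-inverseʳ (det u v) det≢0

    apply : Point → Point
    apply (x , y) = o₁ + x * u₁ + y * v₁ , o₂ + x * u₂ + y * v₂

    -- Cramer's rule
    unapply : Point → Point
    unapply (z₁ , z₂) = ((z₁ - o₁) * v₂ - (z₂ - o₂) * v₁) * δ , (u₁ * (z₂ - o₂) - u₂ * (z₁ - o₁)) * δ

    apply-unapply : ∀ z → apply (unapply z) ≡ z
    apply-unapply (z₁ , z₂) = cong₂ _,_
      (begin
        o₁ + (((z₁ - o₁) * v₂ - (z₂ - o₂) * v₁) * δ) * u₁ + ((u₁ * (z₂ - o₂) - u₂ * (z₁ - o₁)) * δ) * v₁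
          ≡⟨ solve 9 (λ o₁ o₂ z₁ z₂ u₁ u₂ v₁ v₂ δ →
               o₁ :+ (((z₁ :- o₁) :* v₂ :- (z₂ :- o₂) :* v₁) :* δ) :* u₁ :+ ((u₁ :* (z₂ :- o₂) :- u₂ :* (z₁ :- o₁)) :* δ) :* v₁
                 := o₁ :+ (z₁ :- o₁) :* ((u₁ :* v₂ :- u₂ :* v₁) :* δ)) refl o₁ o₂ z₁ z₂ u₁ u₂ v₁ v₂ δ ⟩
        o₁ + (z₁ - o₁) * ((u₁ * v₂ - u₂ * v₁) * δ)
          ≡⟨ cong (λ w → o₁ + (z₁ - o₁) * w) δ-inverse ⟩
        o₁ + (z₁ - o₁) * 1#
          ≡⟨ solve 2 (λ o₁ z₁ → o₁ :+ (z₁ :- o₁) :* :1 := z₁) refl o₁ z₁ ⟩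
        z₁ ∎)
      (begin
        o₂ + (((z₁ - o₁) * v₂ - (z₂ - o₂) * v₁) * δ) * u₂ + ((u₁ * (z₂ - o₂) - u₂ * (z₁ - o₁)) * δ) * v₂
          ≡⟨ solve 9 (λ o₁ o₂ z₁ z₂ u₁ u₂ v₁ v₂ δ →
               o₂ :+ (((z₁ :- o₁) :* v₂ :- (z₂ :- o₂) :* v₁) :* δ) :* u₂ :+ ((u₁ :* (z₂ :- o₂) :- u₂ :* (z₁ :- o₁)) :* δ) :* v₂
                 := o₂ :+ (z₂ :- o₂) :* ((u₁ :* v₂ :- u₂ :* v₁) :* δ)) refl o₁ o₂ z₁ z₂ u₁ u₂ v₁ v₂ δ ⟩
        o₂ + (z₂ - o₂) * ((u₁ * v₂ - u₂ * v₁) * δ)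
          ≡⟨ cong (λ w → o₂ + (z₂ - o₂) * w) δ-inverse ⟩
        o₂ + (z₂ - o₂) * 1#
          ≡⟨ solve 2 (λ o₂ z₂ → o₂ :+ (z₂ :- o₂) :* :1 := z₂) refl o₂ z₂ ⟩
        z₂ ∎)

    unapply-apply : ∀ z → unapply (apply z) ≡ z
    unapply-apply (x , y) = cong₂ _,_
      (begin
        (((o₁ + x * u₁ + y * v₁) - o₁) * v₂ - ((o₂ + x * u₂ + y * v₂) - o₂) * v₁) * δ
          ≡⟨ solve 9 (λ o₁ o₂ x y u₁ u₂ v₁ v₂ δ →
               (((o₁ :+ x :* u₁ :+ y :* v₁) :- o₁) :* v₂ :- ((o₂ :+ x :* u₂ :+ y :* v₂) :- o₂) :* v₁) :* δ
                 := x :* ((u₁ :* v₂ :- u₂ :* v₁) :* δ)) refl o₁ o₂ x y u₁ u₂ v₁ v₂ δ ⟩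
        x * ((u₁ * v₂ - u₂ * v₁) * δ)   ≡⟨ cong (x *_) δ-inverse ⟩
        x * 1#                          ≡⟨ *-identityʳ x ⟩
        x ∎)
      (begin
        (u₁ * ((o₂ + x * u₂ + y * v₂) - o₂) - u₂ * ((o₁ + x * u₁ + y * v₁) - o₁)) * δ
          ≡⟨ solve 9 (λ o₁ o₂ x y u₁ u₂ v₁ v₂ δ →
               (u₁ :* ((o₂ :+ x :* u₂ :+ y :* v₂) :- o₂) :- u₂ :* ((o₁ :+ x :* u₁ :+ y :* v₁) :- o₁)) :* δ
                 := y :* ((u₁ :* v₂ :- u₂ :* v₁) :* δ)) refl o₁ o₂ x y u₁ u₂ v₁ v₂ δ ⟩
        y * ((u₁ * v₂ - u₂ * v₁) * δ)   ≡⟨ cong (y *_) δ-inverse ⟩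
        y * 1#                          ≡⟨ *-identityʳ y ⟩
        y ∎)

    det-apply : ∀ a b c → det (apply b -ₚ apply a) (apply c -ₚ apply a) ≡ det u v * det (b -ₚ a) (c -ₚ a)
    det-apply (a₁ , a₂) (b₁ , b₂) (c₁ , c₂) = solve 12 (λ o₁ o₂ u₁ u₂ v₁ v₂ a₁ a₂ b₁ b₂ c₁ c₂ →
        ((o₁ :+ b₁ :* u₁ :+ b₂ :* v₁) :- (o₁ :+ a₁ :* u₁ :+ a₂ :* v₁)) :* ((o₂ :+ c₁ :* u₂ :+ c₂ :* v₂) :- (o₂ :+ a₁ :* u₂ :+ a₂ :* v₂))
        :- ((o₂ :+ b₁ :* u₂ :+ b₂ :* v₂) :- (o₂ :+ a₁ :* u₂ :+ a₂ :* v₂)) :* ((o₁ :+ c₁ :* u₁ :+ c₂ :* v₁) :- (o₁ :+ a₁ :* u₁ :+ a₂ :* v₁))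
        := (u₁ :* v₂ :- u₂ :* v₁) :* ((b₁ :- a₁) :* (c₂ :- a₂) :- (b₂ :- a₂) :* (c₁ :- a₁))) refl o₁ o₂ u₁ u₂ v₁ v₂ a₁ a₂ b₁ b₂ c₁ c₂

    collineation : Collineation
    collineation = record
      { bijection = mk↔ₛ′ apply unapply apply-unapply unapply-apply
      ; preserves = λ {a} {b} {c} (collinear abc) → collinear (trans (det-apply a b c) (trans (cong (det u v *_) abc) (zeroʳ _)))
      ; reflects  = λ {a} {b} {c} (collinear abc) → collinear (x*y≡0⇒y≡0 det≢0 (trans (sym (det-apply a b c)) abc))
      }

  standardTriangle : Triangle
  standardTriangle zero             = 0# , 0#
  standardTriangle (suc zero)       = 1# , 0#
  standardTriangle (suc (suc zero)) = 0# , 1#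

  module StandardTriangleTo (v : Triangle) (nc : NonCollinear v) where
    open AffineMap (v zero) (v (suc zero) -ₚ v zero) (v (suc (suc zero)) -ₚ v zero) (nc ∘ collinear) public
    private
      a₁ a₂ b₁ b₂ c₁ c₂ : Fin q
      a₁ = proj₁ (v zero)
      a₂ = proj₂ (v zero)
      b₁ = proj₁ (v (suc zero))
      b₂ = proj₂ (v (suc zero))
      c₁ = proj₁ (v (suc (suc zero)))
      c₂ = proj₂ (v (suc (suc zero)))

    apply-standard : ∀ i → apply (standardTriangle i) ≡ v i
    apply-standard zero = cong₂ _,_
      (solve 3 (λ o₁ u₁ v₁ → o₁ :+ :0 :* u₁ :+ :0 :* v₁ := o₁) refl a₁ (b₁ - a₁) (c₁ - a₁))
      (solve 3 (λ o₂ u₂ v₂ → o₂ :+ :0 :* u₂ :+ :0 :* v₂ := o₂) refl a₂ (b₂ - a₂) (c₂ - a₂))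
    apply-standard (suc zero) = cong₂ _,_
      (solve 3 (λ a₁ b₁ c₁ → a₁ :+ :1 :* (b₁ :- a₁) :+ :0 :* (c₁ :- a₁) := b₁) refl a₁ b₁ c₁)
      (solve 3 (λ a₂ b₂ c₂ → a₂ :+ :1 :* (b₂ :- a₂) :+ :0 :* (c₂ :- a₂) := b₂) refl a₂ b₂ c₂)
    apply-standard (suc (suc zero)) = cong₂ _,_
      (solve 3 (λ a₁ b₁ c₁ → a₁ :+ :0 :* (b₁ :- a₁) :+ :1 :* (c₁ :- a₁) := c₁) refl a₁ b₁ c₁)
      (solve 3 (λ a₂ b₂ c₂ → a₂ :+ :0 :* (b₂ :- a₂) :+ :1 :* (c₂ :- a₂) := c₂) refl a₂ b₂ c₂)

  triangle-collineation : ∀ v w → NonCollinear v → NonCollinear w → ∃[ f ] (∀ i → Collineation.to f (v i) ≡ w i)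
  triangle-collineation v w ncv ncw = W.collineation ∘ᶜ (V.collineation ⁻¹ᶜ) , λ i → begin
    W.apply (V.unapply (v i))                    ≡⟨ cong (W.apply ∘ V.unapply) (V.apply-standard i) ⟨
    W.apply (V.unapply (V.apply (standardTriangle i))) ≡⟨ cong W.apply (V.unapply-apply (standardTriangle i)) ⟩
    W.apply (standardTriangle i)                 ≡⟨ W.apply-standard i ⟩
    w i                                          ∎
    where
    module V = StandardTriangleTo v ncv
    module W = StandardTriangleTo w ncw

  automorphism-maps-chambers : ∀ f C D → (∀ i → Collineation.to f (vertices C i) ≡ vertices D i) →
                               ∀ i → Inverse.to (Automorphism.φ (automorphism f)) (ch C i) ≡ ch D i
  automorphism-maps-chambers f C D f-maps i = begin
    elemImage (ch C i)
      ≡⟨ cong elemImage (chamber-≡-triangle C i) ⟩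
    elemImage (triangleElem (vertices C) i)
      ≡⟨ elemImage-corner i (Adjacent.pt≢ (chamber-adjacent-prev C i) ∘ sym) ⟩
    corner (to (vertices C i)) (to (vertices C (prev i))) i
      ≡⟨ cong₂ (λ a c → corner a c i) (f-maps i) (f-maps (prev i)) ⟩
    triangleElem (vertices D) i
      ≡⟨ chamber-≡-triangle D i ⟨
    ch D i ∎
    where
    open Induced f
    open Collineation f using (to)

  flagTransitive : FlagTransitive
  flagTransitive C D =
    let f , f-maps = triangle-collineation (vertices C) (vertices D) (chamber-nonCollinear C) (chamber-nonCollinear D)
    in automorphism f , automorphism-maps-chambers f C D f-maps

module ConnectivityOfΔ {q : ℕ} (F : FiniteField q) where
  open FieldProperties F
  open TriangleComplexOfAG F
  open ≡ using (refl; sym; trans; cong; subst)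

  module WholeGeometry (2<q : 2 ℕ.< q) where
    _~_ : Elem → Elem → Set
    _~_ = Star _∗_

    next-neighbour : ∀ x → ∃[ y ] (ty y ≡ next (ty x) × x ∗ y)
    next-neighbour x with point-off (ln x)
    ... | z , z∉x with another-point-on (join (pt x) z) (pt x)
    ... | y , y∈ , y≢x = elem y (join (pt x) z) y∈ (next (ty x)) , refl , Adjacent⇒∗ (adjacent-intro refl Lx≢ (join-I₁ (pt x) z) (y≢x ∘ sym))
      where
      Lx≢ : ln x ≢ join (pt x) z
      Lx≢ e = z∉x (subst (z I_) (sym e) (join-I₂ (pt x) z))

    same-line-connected : ∀ {x y} → ty x ≡ ty y → ln x ≡ ln y → x ~ y
    same-line-connected {x} {y} x:y Lx≡Ly with pt x ≟ₚ pt y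
    ... | yes px≡py = subst (x ~_) (elem-≡ px≡py Lx≡Ly x:y) ε
    ... | no px≢py with third-point-on 2<q (ln x) (pt x) (pt y) | point-off (ln x)
    ... | r , r∈x , r≢x , r≢y | z , z∉x = Adjacent⇒∗˘ wx ◅ Adjacent⇒∗ wy ◅ ε
      where
      M≢Lx : join r z ≢ ln x
      M≢Lx e = z∉x (subst (z I_) e (join-I₂ r z))
      w : Elem
      w = elem r (join r z) (join-I₁ r z) (prev (ty x))
      wx : Adjacent w x
      wx = adjacent-intro (sym (next³ (ty x))) M≢Lx r∈x r≢x
      wy : Adjacent w y
      wy = adjacent-intro (trans (sym x:y) (sym (next³ (ty x)))) (M≢Lx ∘ (λ e → trans e (sym Lx≡Ly)))
                          (subst (r I_) Lx≡Ly r∈x) r≢y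

    same-point-connected : ∀ {x y} → ty x ≡ ty y → pt x ≡ pt y → x ~ y
    same-point-connected {x} {y} x:y px≡py with ln x ≟ₗ ln y
    ... | yes Lx≡Ly = subst (x ~_) (elem-≡ px≡py Lx≡Ly x:y) ε
    ... | no Lx≢Ly with line-avoiding 2<q (pt x) (ln x) (ln y)
    ... | N , x∈N , N≢x , N≢y with another-point-on N (pt x)
    ... | r , r∈N , r≢x = Adjacent⇒∗ xw ◅ Adjacent⇒∗˘ yw ◅ ε
      where
      w : Elem
      w = elem r N r∈N (next (ty x))
      xw : Adjacent x w
      xw = adjacent-intro refl (N≢x ∘ sym) x∈N (r≢x ∘ sym)
      yw : Adjacent y w
      yw = adjacent-intro (cong next x:y) (N≢y ∘ sym) (subst (_I N) px≡py x∈N) (r≢x ∘ sym ∘ trans px≡py)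

    same-type-connected : ∀ {x y} → ty x ≡ ty y → x ~ y
    same-type-connected {x} {y} x:y with pt x ≟ₚ pt y
    ... | yes px≡py = same-point-connected x:y px≡py
    ... | no _      =
      same-point-connected {x} {x'} refl refl ◅◅ same-line-connected {x'} {y'} refl refl ◅◅ same-point-connected {y'} {y} x:y refl
      where
      x' y' : Elem
      x' = elem (pt x) (join (pt x) (pt y)) (join-I₁ _ _) (ty x)
      y' = elem (pt y) (join (pt x) (pt y)) (join-I₂ _ _) (ty x)

    connected : ∀ x y → x ~ y
    connected x y with next-neighbour x
    ... | x₁ , x₁:next , x∗x₁ with next-neighbour x₁
    ... | x₂ , x₂:next , x₁∗x₂ with next-cases (ty y) (ty x)
    ... | inj₁ y:x        = same-type-connected (sym y:x)
    ... | inj₂ (inj₁ y:n) = x∗x₁ ◅ same-type-connected (trans x₁:next (sym y:n))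
    ... | inj₂ (inj₂ y:p) = x∗x₁ ◅ x₁∗x₂ ◅ same-type-connected (trans x₂:next (trans (cong next x₁:next) (sym y:p)))

  module Residue (3<q : 3 ℕ.< q) (a : Elem) where
    t : Fin 3
    t = ty a
    p : Point
    p = pt a
    L : Line
    L = ln a

    InResidue : Elem → Set
    InResidue x = ty x ≢ t × x ∗ a

    Edge : Elem → Elem → Set
    Edge x y = InResidue x × InResidue y × x ∗ y

    Edge-sym : ∀ {x y} → Edge x y → Edge y x
    Edge-sym (x∈ , y∈ , x∗y) = y∈ , x∈ , ∗-sym x∗y

    outer-adjacent : ∀ {y} → InResidue y → ty y ≡ next t → Adjacent a y
    outer-adjacent (_ , y∗a) y:next = ∗⇒Adjacent refl y:next (∗-sym y∗a)

    outer-∉ : ∀ {y} → InResidue y → ty y ≡ next t → ¬ pt y I L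
    outer-∉ {y} y∈ y:next y∈L = Adjacent.pt≢ ay (sym (meet-unique (Adjacent.meets ay) y∈L (inc y)))
      where
      ay : Adjacent a y
      ay = outer-adjacent y∈ y:next

    inner-adjacent : ∀ {z} → InResidue z → ty z ≡ prev t → Adjacent z a
    inner-adjacent (_ , z∗a) z:prev = ∗⇒Adjacent z:prev (sym (next³ t)) z∗a

    outer : Point → Elem
    outer u = elem u (join p u) (join-I₂ p u) (next t)

    outer-in : ∀ {u} → ¬ u I L → InResidue (outer u)
    outer-in {u} u∉L =
      next≢id t , Adjacent⇒∗˘ (adjacent-intro refl L≢pu (join-I₁ p u) (u∉L ∘ (λ e → subst (_I L) e (inc a))))
      where
      L≢pu : L ≢ join p u
      L≢pu e = u∉L (subst (u I_) (sym e) (join-I₂ p u))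

    inner : ∀ r M → r I M → Elem
    inner r M r∈M = elem r M r∈M (prev t)

    inner-in : ∀ {r M} (r∈M : r I M) → r I L → r ≢ p → M ≢ L → InResidue (inner r M r∈M)
    inner-in r∈M r∈L r≢p M≢L = prev≢id t , Adjacent⇒∗ (adjacent-intro (sym (next³ t)) M≢L r∈L r≢p)

    outer-inner-∗ : ∀ {y z} → InResidue y → ty y ≡ next t → InResidue z → ty z ≡ prev t → pt y I ln z → y ∗ z
    outer-inner-∗ {y} {z} y∈ y:next z∈ z:prev y∈z =
      Adjacent⇒∗ (adjacent-intro (trans z:prev (cong next (sym y:next))) lines-differ y∈z points-differ)
      where
      za : Adjacent z a
      za = inner-adjacent z∈ z:prev
      lines-differ : ln y ≢ ln z
      lines-differ e = Adjacent.pt≢ za (sym (meet-unique (Adjacent.meets za)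
        (subst (p I_) e (Adjacent.pt-I (outer-adjacent y∈ y:next))) (inc a)))
      points-differ : pt y ≢ pt z
      points-differ e = outer-∉ y∈ y:next (subst (_I L) (sym e) (Adjacent.pt-I za))

    outer-inner-edge : ∀ {u z} (u∉L : ¬ u I L) → InResidue z → ty z ≡ prev t → u I ln z → Edge (outer u) z
    outer-inner-edge u∉L z∈ z:prev u∈z = outer-in u∉L , z∈ , outer-inner-∗ (outer-in u∉L) refl z∈ z:prev u∈z

    r₀ : Point
    r₀ = proj₁ (another-point-on L p)
    r₀∈L : r₀ I L
    r₀∈L = proj₁ (proj₂ (another-point-on L p))
    r₀≢p : r₀ ≢ p
    r₀≢p = proj₂ (proj₂ (another-point-on L p))
    w₀ : Point
    w₀ = proj₁ (point-off L)
    M₀ : Line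
    M₀ = join r₀ w₀

    M₀≢L : M₀ ≢ L
    M₀≢L e = proj₂ (point-off L) (subst (w₀ I_) e (join-I₂ r₀ w₀))

    hub : Elem
    hub = inner r₀ M₀ (join-I₁ r₀ w₀)

    hub-in : InResidue hub
    hub-in = inner-in (join-I₁ r₀ w₀) r₀∈L r₀≢p M₀≢L

    -- A line through a third point r₁ of L meeting both ln z and M₀ links the two inner elements at r₀.
    through-r₀-to-hub : ∀ {z} → InResidue z → ty z ≡ prev t → pt z ≡ r₀ → Star Edge z hub
    through-r₀-to-hub {z} z∈ z:prev z≡r₀ with ln z ≟ₗ M₀
    ... | yes Lz≡M₀ = subst (λ w → Star Edge w hub) (sym (elem-≡ z≡r₀ Lz≡M₀ z:prev)) ε
    ... | no _ with third-point-on (ℕ.<⇒≤ 3<q) L p r₀ | avoid₃ 3<q (gradient L) (gradient (ln z)) (gradient M₀)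
    ... | r₁ , r₁∈L , r₁≢p , r₁≢r₀ | m , m≢L , m≢z , m≢M₀
      with slope-meets m _ (ln z) (m≢z ∘ sym) | slope-meets m _ M₀ (m≢M₀ ∘ sym)
    ... | u₁ , u₁∈N , u₁∈z | u₂ , u₂∈N , u₂∈M₀ =
      Edge-sym (outer-inner-edge u₁∉L z∈ z:prev u₁∈z) ◅ outer-inner-edge u₁∉L N∈ refl u₁∈N ◅
      Edge-sym (outer-inner-edge u₂∉L N∈ refl u₂∈N) ◅ outer-inner-edge u₂∉L hub-in refl u₂∈M₀ ◅ ε
      where
      N : Line
      N = slopeThrough m r₁
      N≢L : N ≢ L
      N≢L = ≢-gradient⇒≢ m≢L
      N∈ : InResidue (inner r₁ N (slopeThrough-I m r₁))
      N∈ = inner-in (slopeThrough-I m r₁) r₁∈L r₁≢p N≢L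
      on-N∩L : ∀ {u} → u I N → u I L → u ≡ r₁
      on-N∩L u∈N u∈L = lines-meet-once N≢L u∈N u∈L (slopeThrough-I m r₁) r₁∈L
      u₁∉L : ¬ u₁ I L
      u₁∉L u₁∈L = r₁≢r₀ (trans (sym (on-N∩L u₁∈N u₁∈L))
        (trans (meet-unique (Adjacent.meets (inner-adjacent z∈ z:prev)) u₁∈z u₁∈L) z≡r₀))
      u₂∉L : ¬ u₂ I L
      u₂∉L u₂∈L = r₁≢r₀ (trans (sym (on-N∩L u₂∈N u₂∈L))
        (lines-meet-once M₀≢L u₂∈M₀ u₂∈L (join-I₁ r₀ w₀) r₀∈L))

    outer-to-hub : ∀ {y} → InResidue y → ty y ≡ next t → Star Edge y hub
    outer-to-hub {y} y∈ y:next =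
      (y∈ , z∈ , outer-inner-∗ y∈ y:next z∈ refl (join-I₂ r₀ (pt y))) ◅ through-r₀-to-hub z∈ refl refl
      where
      z∈ : InResidue (inner r₀ (join r₀ (pt y)) (join-I₁ r₀ (pt y)))
      z∈ = inner-in (join-I₁ r₀ (pt y)) r₀∈L r₀≢p λ e → outer-∉ y∈ y:next (subst (pt y I_) e (join-I₂ r₀ (pt y)))

    inner-to-hub : ∀ {z} → InResidue z → ty z ≡ prev t → Star Edge z hub
    inner-to-hub {z} z∈ z:prev with another-point-on (ln z) (pt z)
    ... | u , u∈z , u≢z = Edge-sym (outer-inner-edge u∉L z∈ z:prev u∈z) ◅ outer-to-hub (outer-in u∉L) refl
      where
      u∉L : ¬ u I L
      u∉L u∈L = u≢z (meet-unique (Adjacent.meets (inner-adjacent z∈ z:prev)) u∈z u∈L)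

    to-hub : ∀ {x} → InResidue x → Star Edge x hub
    to-hub {x} x∈ with next-cases (ty x) t
    ... | inj₁ x:t        = contradiction x:t (proj₁ x∈)
    ... | inj₂ (inj₁ x:n) = outer-to-hub x∈ x:n
    ... | inj₂ (inj₂ x:p) = inner-to-hub x∈ x:p

    residue-connected : ∀ {x y} → InResidue x → InResidue y → Star Edge x y
    residue-connected x∈ y∈ = to-hub x∈ ◅◅ reverse Edge-sym (to-hub y∈)

  absent-next-prev : ∀ (F : Flag) {i j} → i ≢ j → el F i ≡ nothing → el F j ≡ nothing →
                     ∃[ t ] (el F (next t) ≡ nothing × el F (prev t) ≡ nothing)
  absent-next-prev F i≢j Fi Fj with complement-next-prev i≢j
  ... | t , inj₁ (refl , refl) = t , Fi , Fj
  ... | t , inj₂ (refl , refl) = t , Fj , Fi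

  empty-residue : ∀ (F : Flag) → (∀ i → el F i ≡ nothing) → ∀ u → InRes F u
  empty-residue F empty u = empty (ty u) , λ i x Fi≡x → contradiction (trans (sym (empty i)) Fi≡x) λ ()

  module SingletonFlag (F : Flag) {t a} (Ft : el F t ≡ just a)
                       (Fn : el F (next t) ≡ nothing) (Fp : el F (prev t) ≡ nothing) (3<q : 3 ℕ.< q) where
    open Residue 3<q a using (InResidue)

    a:t : ty a ≡ t
    a:t = typed F t a Ft

    InRes⇒InResidue : ∀ {u} → InRes F u → InResidue u
    InRes⇒InResidue (Fu , u∗F) = (λ u:a → contradiction (trans (sym Fu) (trans (cong (el F) (trans u:a a:t)) Ft)) λ ())
                                , u∗F t a Ft

    InResidue⇒InRes : ∀ {u} → InResidue u → InRes F u
    InResidue⇒InRes {u} (u≢a , u∗a) = Fu , u∗F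
      where
      Fu : el F (ty u) ≡ nothing
      Fu with next-cases (ty u) t
      ... | inj₁ u:t        = contradiction (trans u:t (sym a:t)) u≢a
      ... | inj₂ (inj₁ u:n) = trans (cong (el F) u:n) Fn
      ... | inj₂ (inj₂ u:p) = trans (cong (el F) u:p) Fp
      u∗F : ∀ i x → el F i ≡ just x → u ∗ x
      u∗F i x Fi≡x with next-cases i t
      ... | inj₁ refl        = subst (u ∗_) (just-injective (trans (sym Ft) Fi≡x)) u∗a
      ... | inj₂ (inj₁ refl) = contradiction (trans (sym Fn) Fi≡x) λ ()
      ... | inj₂ (inj₂ refl) = contradiction (trans (sym Fp) Fi≡x) λ ()

  residuallyConnected : 3 ℕ.< q → ResiduallyConnected
  residuallyConnected 3<q F (i , j , i≢j , Fi , Fj) x y x∈ y∈ with absent-next-prev F i≢j Fi Fj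
  ... | t , Fn , Fp with el F t in Ft
  ... | nothing = gmap id (λ {u} {v} u∗v → empty-residue F empty u , empty-residue F empty v , u∗v)
                          (WholeGeometry.connected (ℕ.<⇒≤ 3<q) x y)
    where
    empty : ∀ k → el F k ≡ nothing
    empty k with next-cases k t
    ... | inj₁ refl        = Ft
    ... | inj₂ (inj₁ refl) = Fn
    ... | inj₂ (inj₂ refl) = Fp
  ... | just a = gmap id (λ (u∈ , v∈ , u∗v) → InResidue⇒InRes u∈ , InResidue⇒InRes v∈ , u∗v)
                         (Residue.residue-connected 3<q a (InRes⇒InResidue x∈) (InRes⇒InResidue y∈))
    where open SingletonFlag F Ft Fn Fp 3<q

module DualitiesOfΔ {q : ℕ} (F : FiniteField q) (2<q : 2 ℕ.< q) where
  open FieldProperties F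
  open TriangleComplexOfAG F
  open IncSysProperties Δ
  open ≡ using (refl; sym; trans; cong; subst; subst₂)

  Linked⇒same-line : ∀ {u x y} → ty x ≡ u → ty y ≡ u → Linked (prev u) (next u) x y → ln x ≡ ln y
  Linked⇒same-line {u} {x} {y} x:u y:u (_ , (d , d:prev , x∗d , y∗d) , ¬next-common) with ln x ≟ₗ ln y
  ... | yes Lx≡Ly = Lx≡Ly
  ... | no Lx≢Ly with third-point-on 2<q (join (pt x) (pt y)) (pt x) (pt y)
  ... | r , r∈M , r≢x , r≢y = contradiction (c , refl , Adjacent⇒∗ xc , Adjacent⇒∗ yc) ¬next-common
    where
    dx : Adjacent d x
    dx = ∗⇒Adjacent d:prev (trans x:u (sym (next³ u))) (∗-sym x∗d)
    dy : Adjacent d y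
    dy = ∗⇒Adjacent d:prev (trans y:u (sym (next³ u))) (∗-sym y∗d)
    x∉Ly : ¬ pt x I ln y
    x∉Ly x∈Ly = Adjacent.pt≢ dx (lines-meet-once Lx≢Ly (Adjacent.pt-I dx) (Adjacent.pt-I dy) (inc x) x∈Ly)
    y∉Lx : ¬ pt y I ln x
    y∉Lx y∈Lx = Adjacent.pt≢ dy (lines-meet-once Lx≢Ly (Adjacent.pt-I dx) (Adjacent.pt-I dy) y∈Lx (inc y))
    M : Line
    M = join (pt x) (pt y)
    c : Elem
    c = elem r M r∈M (next u)
    xc : Adjacent x c
    xc = adjacent-intro (cong next (sym x:u)) (λ e → y∉Lx (subst (pt y I_) (sym e) (join-I₂ _ _))) (join-I₁ _ _) (r≢x ∘ sym)
    yc : Adjacent y c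
    yc = adjacent-intro (cong next (sym y:u)) (λ e → x∉Ly (subst (pt x I_) (sym e) (join-I₁ _ _))) (join-I₂ _ _) (r≢y ∘ sym)

  same-line⇒Linked : ∀ {u x y} → ty x ≡ u → ty y ≡ u → ln x ≡ ln y → x ≢ y → Linked (prev u) (next u) x y
  same-line⇒Linked {u} {x} {y} x:u y:u Lx≡Ly x≢y with third-point-on 2<q (ln x) (pt x) (pt y) | point-off (ln x)
  ... | r , r∈L , r≢x , r≢y | z , z∉L = x≢y , (d , refl , Adjacent⇒∗˘ dx , Adjacent⇒∗˘ dy) , no-next-common
    where
    M≢L : join r z ≢ ln x
    M≢L e = z∉L (subst (z I_) e (join-I₂ r z))
    d : Elem
    d = elem r (join r z) (join-I₁ r z) (prev u)
    dx : Adjacent d x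
    dx = adjacent-intro (trans x:u (sym (next³ u))) M≢L r∈L r≢x
    dy : Adjacent d y
    dy = adjacent-intro (trans y:u (sym (next³ u))) (λ e → M≢L (trans e (sym Lx≡Ly))) (subst (r I_) Lx≡Ly r∈L) r≢y
    no-next-common : ¬ CommonNeighbour (next u) x y
    no-next-common (c , c:next , x∗c , y∗c) = x≢y (elem-≡ px≡py Lx≡Ly (trans x:u (sym y:u)))
      where
      xc : Adjacent x c
      xc = ∗⇒Adjacent x:u c:next x∗c
      yc : Adjacent y c
      yc = ∗⇒Adjacent y:u c:next y∗c
      px≡py : pt x ≡ pt y
      px≡py = sym (meet-unique (Adjacent.meets xc) (subst (pt y I_) (sym Lx≡Ly) (inc y)) (Adjacent.pt-I yc))

  Linked-transitive : ∀ {u x y z} → ty x ≡ u → ty y ≡ u → ty z ≡ u →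
    Linked (prev u) (next u) x y → Linked (prev u) (next u) y z → x ≢ z → Linked (prev u) (next u) x z
  Linked-transitive x:u y:u z:u xy yz x≢z =
    same-line⇒Linked x:u z:u (trans (Linked⇒same-line x:u y:u xy) (Linked⇒same-line y:u z:u yz)) x≢z

  no-common-prev : ∀ {s x y} → ty x ≡ s → ty y ≡ s → (∀ u → u I ln x → u I ln y → u ≡ pt x) →
                   ¬ CommonNeighbour (prev s) x y
  no-common-prev {s} {x} {y} x:s y:s meet-at-x (c , c:prev , x∗c , y∗c) =
    Adjacent.pt≢ cx (meet-at-x (pt c) (Adjacent.pt-I cx) (Adjacent.pt-I cy))
    where
    cx : Adjacent c x
    cx = ∗⇒Adjacent c:prev (trans x:s (sym (next³ s))) (∗-sym x∗c)
    cy : Adjacent c y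
    cy = ∗⇒Adjacent c:prev (trans y:s (sym (next³ s))) (∗-sym y∗c)

  module NonTransitivity (s : Fin 3) where
    diagonal : Line
    diagonal = slope 1# 0#

    on-diagonal : ∀ t → (t , t) I diagonal
    on-diagonal t = solve 1 (λ t → t := :1 :* t :+ :0) refl t

    x₁ x₂ x₃ : Elem
    x₁ = elem (0# , 0#) (slope 0# 0#) (solve 0 (:0 := :0 :* :0 :+ :0) refl) s
    x₂ = elem (0# , 0#) (vert 0#) refl s
    x₃ = elem (1# , 1#) (vert 1#) refl s

    x₁x₂ : Linked (next s) (prev s) x₁ x₂
    x₁x₂ = (λ ()) , (d , refl , Adjacent⇒∗ x₁d , Adjacent⇒∗ x₂d) , no-common-prev refl refl meet
      where
      d : Elem
      d = elem (1# , 1#) diagonal (on-diagonal 1#) (next s)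
      x₁d : Adjacent x₁ d
      x₁d = adjacent-intro refl (≢-gradient⇒≢ 0≢1) (on-diagonal 0#) (0≢1 ∘ cong proj₁)
      x₂d : Adjacent x₂ d
      x₂d = adjacent-intro refl (λ ()) (on-diagonal 0#) (0≢1 ∘ cong proj₁)
      meet : ∀ u → u I slope 0# 0# → u I vert 0# → u ≡ (0# , 0#)
      meet (_ , y) y≡0*0+0 refl = cong (0# ,_) (trans y≡0*0+0 (solve 0 (:0 :* :0 :+ :0 := :0) refl))

    x₂x₃ : Linked (next s) (prev s) x₂ x₃
    x₂x₃ with avoid₂ 2<q 0# 1#
    ... | t , t≢0 , t≢1 =
      (0≢1 ∘ cong (proj₁ ∘ pt)) , (d , refl , Adjacent⇒∗ x₂d , Adjacent⇒∗ x₃d) , no-common-prev refl refl parallel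
      where
      d : Elem
      d = elem (t , t) diagonal (on-diagonal t) (next s)
      x₂d : Adjacent x₂ d
      x₂d = adjacent-intro refl (λ ()) (on-diagonal 0#) (t≢0 ∘ sym ∘ cong proj₁)
      x₃d : Adjacent x₃ d
      x₃d = adjacent-intro refl (λ ()) (on-diagonal 1#) (t≢1 ∘ sym ∘ cong proj₁)
      parallel : ∀ u → u I vert 0# → u I vert 1# → u ≡ (0# , 0#)
      parallel _ refl 0≡1 = contradiction 0≡1 0≢1

    x₁≢x₃ : x₁ ≢ x₃
    x₁≢x₃ ()

    ¬x₁x₃ : ¬ Linked (next s) (prev s) x₁ x₃
    ¬x₁x₃ (_ , _ , ¬prev-common) = ¬prev-common (c , refl , Adjacent⇒∗˘ cx₁ , Adjacent⇒∗˘ cx₃)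
      where
      c : Elem
      c = elem (1# , 0#) (slope 1# (- 1#)) (solve 0 (:0 := :1 :* :1 :- :1) refl) (prev s)
      cx₁ : Adjacent c x₁
      cx₁ = adjacent-intro (sym (next³ s)) (≢-gradient⇒≢ 1≢0) (solve 0 (:0 := :0 :* :1 :+ :0) refl) (1≢0 ∘ cong proj₁)
      cx₃ : Adjacent c x₃
      cx₃ = adjacent-intro (sym (next³ s)) (λ ()) refl (0≢1 ∘ cong proj₂)

  transposition-swaps-next : ∀ {σ} → IsTransposition σ → ∃[ s ] (σ s ≡ next s × σ (next s) ≡ s × σ (prev s) ≡ prev s)
  transposition-swaps-next (zero , zero , i≢j , _) = contradiction refl i≢j
  transposition-swaps-next (zero , suc zero , _ , σi , σj , fixes) = zero , σi , σj , fixes _ (λ ()) (λ ())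
  transposition-swaps-next (zero , suc (suc zero) , _ , σi , σj , fixes) = suc (suc zero) , σj , σi , fixes _ (λ ()) (λ ())
  transposition-swaps-next (suc zero , zero , _ , σi , σj , fixes) = zero , σj , σi , fixes _ (λ ()) (λ ())
  transposition-swaps-next (suc zero , suc zero , i≢j , _) = contradiction refl i≢j
  transposition-swaps-next (suc zero , suc (suc zero) , _ , σi , σj , fixes) = suc zero , σi , σj , fixes _ (λ ()) (λ ())
  transposition-swaps-next (suc (suc zero) , zero , _ , σi , σj , fixes) = suc (suc zero) , σi , σj , fixes _ (λ ()) (λ ())
  transposition-swaps-next (suc (suc zero) , suc zero , _ , σi , σj , fixes) = suc zero , σj , σi , fixes _ (λ ()) (λ ())
  transposition-swaps-next (suc (suc zero) , suc (suc zero) , i≢j , _) = contradiction refl i≢j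

  swap-involutive : ∀ σ {s} → σ s ≡ next s → σ (next s) ≡ s → σ (prev s) ≡ prev s → ∀ i → σ (σ i) ≡ i
  swap-involutive σ {s} σs σn σp i with next-cases i s
  ... | inj₁ refl        = trans (cong σ σs) σn
  ... | inj₂ (inj₁ refl) = trans (cong σ σn) σs
  ... | inj₂ (inj₂ refl) = trans (cong σ σp) σp

  noDuality : ¬ AdmitsDuality
  noDuality (c , _ , σ , induces , transposition) with transposition-swaps-next transposition
  ... | s , σs , σn , σp =
    ¬x₁x₃ (subst₂ (Linked (next s) (prev s)) (strictlyInverseʳ x₁) (strictlyInverseʳ x₃) linked₁₃)
    where
    open NonTransitivity s
    φ : Elem ↔ Elem
    φ = Correlation.φ c
    open Inverse φ
    ty-from : ∀ z → ty (from z) ≡ σ (ty z)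
    ty-from z = trans (sym (swap-involutive σ σs σn σp _)) (cong σ (trans (sym (induces (from z))) (cong ty (strictlyInverseˡ z))))
    sends : ∀ (f : Elem → Elem) → (∀ z → ty (f z) ≡ σ (ty z)) → ∀ {i j} → σ i ≡ j → ∀ z → ty z ≡ i → ty (f z) ≡ j
    sends f f-ty σi≡j z z:i = trans (f-ty z) (trans (cong σ z:i) σi≡j)
    forward : ∀ {x y} → Linked (next s) (prev s) x y → Linked (prev (next s)) (next (next s)) (to x) (to y)
    forward = Linked-transport φ (Correlation.inc c) (sends to induces (trans σn (sym (next³ s)))) (sends from ty-from σp)
    backward : ∀ {x y} → Linked (prev (next s)) (next (next s)) x y → Linked (next s) (prev s) (from x) (from y)
    backward = Linked-transport (↔-sym φ) (PreservesInc-inverse φ (Correlation.inc c))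
                 (sends from ty-from (trans (cong σ (next³ s)) σs)) (sends to induces σp)
    linked₁₃ : Linked (next s) (prev s) (from (to x₁)) (from (to x₃))
    linked₁₃ = backward (Linked-transitive
      (sends to induces σs x₁ refl) (sends to induces σs x₂ refl) (sends to induces σs x₃ refl)
      (forward x₁x₂) (forward x₂x₃) (x₁≢x₃ ∘ Injection.injective (↔⇒↣ φ)))

corollary5p6 : ∀ (q : ℕ) (F : FiniteField q) → 3 < q →
    let open IncSysNotions (ΔAG F) in
    IsGeometry × Thick × ResiduallyConnected × FlagTransitive ×
    AdmitsTriality × ¬ AdmitsDuality
corollary5p6 q F 3<q =
    GeometryOfΔ.geometry F
  , GeometryOfΔ.thick F 3<q
  , ConnectivityOfΔ.residuallyConnected F 3<q
  , Collineations.flagTransitive F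
  , TriangleComplexOfAG.triality F (TriangleComplexOfAG.origin-on-y-axis F)
  , DualitiesOfΔ.noDuality F (ℕ.<⇒≤ 3<q)
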